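{- Let $x$ be a fixed-point-free involution in $S_{2n}$. Then $|\mathcal{A}_{\mathrm{FPF}}(x)|=1$ if and only if $x$ is 321-avoiding.
   Context: $S_{2n}$ has simple generators $s_i=(i,i+1)$ and length $\ell$. The Demazure product $\circ$ is the unique associative operation on $S_{2n}$ with $s\circ w = sw$ if $\ell(sw)>\ell(w)$ and $s\circ w=w$ otherwise, and $w\circ s=ws$ if $\ell(ws)>\ell(w)$ and $w\circ s = w$ otherwise. Let $w_{\mathrm{fpf}}=s_1s_3\cdots s_{2n-1}$; $\mathcal{A}_{\mathrm{FPF}}(x)$ is the set of minimal-length $w\in S_{2n}$ with $w^{ -1}\circ w_{\mathrm{fpf}}\circ w=x$. A permutation $w$ is 321-avoiding if there are no $i<j<k$ with $w(i)>w(j)>w(k)$. -}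

module Defs where

open import Data.Nat using (ℕ; zero; suc; _*_; _≤_)
import Data.Nat as ℕ
open import Data.Fin using (Fin; zero; suc; toℕ; _<_)
open import Data.Fin.Permutation as P
  using (Permutation′; _⟨$⟩ʳ_; _∘ₚ_; flip; transpose; permutation; _≈_)
open import Data.Fin.Properties using (_<?_)
open import Data.List using (List; length; filter; allFin; cartesianProduct)
open import Data.Product using (Σ; ∃; ∃-syntax; _×_; _,_; proj₁; proj₂)
open import Relation.Nullary using (¬_)
open import Relation.Nullary.Decidable using (_×-dec_)
open import Relation.Binary.PropositionalEquality using (_≡_; _≢_; refl; cong)

-- Permutations of {0,…,m-1} (0-indexed version of {1,…,m})

Perm : ℕ → Set
Perm m = Permutation′ m

-- Product in the symmetric group: (u · v)(i) = u (v i)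
-- (note: in the stdlib, (π₁ ∘ₚ π₂) applies π₁ first).
infixl 7 _·_
_·_ : ∀ {m} → Perm m → Perm m → Perm m
u · v = v ∘ₚ u

_⁻¹ : ∀ {m} → Perm m → Perm m
w ⁻¹ = flip w

-- Coxeter length = number of inversions

inversions : ∀ {m} → Perm m → List (Fin m × Fin m)
inversions w = filter (λ p → (proj₁ p <? proj₂ p) ×-dec
                             ((w ⟨$⟩ʳ proj₂ p) <? (w ⟨$⟩ʳ proj₁ p)))
                      (cartesianProduct (allFin _) (allFin _))

ℓ : ∀ {m} → Perm m → ℕ
ℓ w = length (inversions w)

IsSimple : ∀ {m} → Perm m → Set
IsSimple {m} s = Σ (Fin m) λ i → Σ (Fin m) λ j →
  (toℕ j ≡ suc (toℕ i)) × (s ≈ transpose i j)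

-- Such an operation exists and is unique.

record IsDemazureProduct {m} (_⊙_ : Perm m → Perm m → Perm m) : Set where
  field
    cong-⊙ : ∀ {u u′ v v′} → u ≈ u′ → v ≈ v′ → (u ⊙ v) ≈ (u′ ⊙ v′)
    assoc  : ∀ u v w → ((u ⊙ v) ⊙ w) ≈ (u ⊙ (v ⊙ w))
    left-up    : ∀ s w → IsSimple s → ℓ w ℕ.< ℓ (s · w) → (s ⊙ w) ≈ (s · w)
    left-down  : ∀ s w → IsSimple s → ¬ (ℓ w ℕ.< ℓ (s · w)) → (s ⊙ w) ≈ w
    right-up   : ∀ s w → IsSimple s → ℓ w ℕ.< ℓ (w · s) → (w ⊙ s) ≈ (w · s)
    right-down : ∀ s w → IsSimple s → ¬ (ℓ w ℕ.< ℓ (w · s)) → (w ⊙ s) ≈ w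

-- w_fpf = s_1 s_3 ⋯ s_{2n-1}: swaps 1↔2, 3↔4, …, (2n-1)↔2n
-- (0-indexed: 2k ↔ 2k+1).  Written out pointwise via `pairSwap`
-- (for odd sizes the last point would be fixed; only even sizes are used).

pairSwap : ∀ {k} → Fin k → Fin k
pairSwap {suc zero} zero = zero
pairSwap {suc (suc k)} zero = suc zero
pairSwap {suc (suc k)} (suc zero) = zero
pairSwap {suc (suc k)} (suc (suc i)) = suc (suc (pairSwap i))

pairSwap-invol : ∀ {k} (i : Fin k) → pairSwap (pairSwap i) ≡ i
pairSwap-invol {suc zero} zero = refl
pairSwap-invol {suc (suc k)} zero = refl
pairSwap-invol {suc (suc k)} (suc zero) = refl
pairSwap-invol {suc (suc k)} (suc (suc i)) = cong (λ x → suc (suc x)) (pairSwap-invol i)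

wfpf : (n : ℕ) → Perm (2 * n)
wfpf n = permutation pairSwap pairSwap pairSwap-invol pairSwap-invol

IsFPFInvolution : ∀ {m} → Perm m → Set
IsFPFInvolution x = (x · x ≈ P.id) × (∀ i → x ⟨$⟩ʳ i ≢ i)

FPFCond : ∀ n → (Perm (2 * n) → Perm (2 * n) → Perm (2 * n)) →
          Perm (2 * n) → Perm (2 * n) → Set
FPFCond n _⊙_ x w = ((w ⁻¹) ⊙ (wfpf n ⊙ w)) ≈ x

InAFPF : ∀ n → (Perm (2 * n) → Perm (2 * n) → Perm (2 * n)) →
         Perm (2 * n) → Perm (2 * n) → Set
InAFPF n _⊙_ x w =
  FPFCond n _⊙_ x w × (∀ v → FPFCond n _⊙_ x v → ℓ w ≤ ℓ v)

-- |A_FPF(x)| = 1 (elements of S_{2n} compared by equality of permutations)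
AFPFSingleton : ∀ n → (Perm (2 * n) → Perm (2 * n) → Perm (2 * n)) →
                Perm (2 * n) → Set
AFPFSingleton n _⊙_ x =
  ∃[ w ] (InAFPF n _⊙_ x w × (∀ v → InAFPF n _⊙_ x v → v ≈ w))

Avoids321 : ∀ {m} → Perm m → Set
Avoids321 {m} w = ¬ (Σ (Fin m) λ i → Σ (Fin m) λ j → Σ (Fin m) λ k →
  (i < j) × (j < k) ×
  (w ⟨$⟩ʳ j < w ⟨$⟩ʳ i) × (w ⟨$⟩ʳ k < w ⟨$⟩ʳ j))

-- Write ψ w = w⁻¹ ∘ w_fpf ∘ w.  If s is a simple transposition with ℓ(ws) > ℓ(w), then ψ(ws) is
-- either ψ(w) or s ψ(w) s, the latter being longer by two.  Hence ψ(w) is always a fixed-point-free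
-- involution with ℓ(ψ w) ≤ ℓ(w_fpf) + 2ℓ(w), and A_FPF(x) is the set of atoms of x: the w with
-- ψ(w) = x attaining this bound.  Atoms exist because x is either w_fpf or has a visible descent
-- (x(i+1) < x(i) ≠ i+1), at which s_i x s_i is shorter by two; conversely, every right descent of
-- an atom of x is a visible descent of x.
-- When x avoids 321 its visible descents lie on disjoint arcs, so two atoms ending in different
-- descents are identified by a diamond argument, and induction on ℓ(x) gives uniqueness.
-- A 321 pattern gives a nesting a < a′ < x(a′) < x(a).  Conjugating by s_i at a visible descent
-- preserves a nesting unless the nesting has i, i+1 as its two left or its two right ends.  In that
-- case either the nesting is tight (a′ = a+1 and x(a) = x(a′)+1), so that s_a x s_a = s_{x(a′)} x s_{x(a′)}
-- and one atom of it lifts to two atoms of x, or another visible descent preserves a nesting and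
-- induction on ℓ(x) applies.

module Submission where

open import Defs
open import Data.Nat as ℕ using (ℕ; zero; suc; _+_; _*_; z≤n; s≤s)
open import Data.Nat.Properties
  using ( +-assoc; +-comm; +-suc; +-mono-≤; +-monoʳ-≤; +-mono-<; +-cancelˡ-≤; m≤m+n
        ; ≤-refl; ≤-reflexive; ≤-trans; ≤-antisym; ≤-pred; <⇒≤; <⇒≱; ≰⇒>; ≤∧≢⇒<; ≤∧≮⇒≡
        ; <-irrefl; <-asym; n≤1+n; n<1+n; m≤n⇒m<n∨m≡n; suc-injective; 1+n≢n; 0≢1+n; even≢odd
        ; module ≤-Reasoning )
open import Data.Nat.Induction using (<-wellFounded)
open import Algebra.Properties.CommutativeSemigroup Data.Nat.Properties.+-commutativeSemigroup
  using (xy∙z≈xz∙y)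
open import Algebra.Properties.CommutativeMonoid.Sum Data.Nat.Properties.+-0-commutativeMonoid
  using (sum; sum-cong-≗; sum-replicate-zero; sum-permute; ∑-comm)
open import Data.Fin as F using (Fin; zero; suc; toℕ; inject₁; fromℕ; fromℕ<)
open import Data.Fin.Properties
  using (_≟_; _<?_; <-cmp; <-trans; <⇒≢; any?; toℕ-injective; toℕ-inject₁; toℕ-fromℕ; toℕ-fromℕ<; toℕ<n)
import Data.Fin.Properties as Finₚ
open import Data.Fin.Induction using (<-weakInduction; >-weakInduction)
open import Data.Fin.Permutation as P using (_⟨$⟩ʳ_; _⟨$⟩ˡ_; transpose; _≈_)
open import Data.List using (length; filter; map; tabulate; _++_; cartesianProduct)
open import Data.List.Properties using (length-++; filter-++; map-tabulate)
open import Data.Product using (Σ; ∃; _×_; _,_; proj₁; proj₂)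
open import Data.Sum using (_⊎_; inj₁; inj₂; [_,_]′) renaming (map to ⊎-map)
open import Data.Empty using (⊥; ⊥-elim)
open import Function using (_∘_; _$_; _⇔_; Equivalence; mk⇔)
open import Induction.WellFounded using (module All)
open import Level using (0ℓ)
open import Relation.Nullary using (¬_; ¬?; Dec; yes; no)
open import Relation.Nullary.Decidable using (_×-dec_)
open import Relation.Unary using (Pred; Decidable)
open import Relation.Binary using (tri<; tri≈; tri>)
open import Relation.Binary.Bundles using (Setoid)
import Relation.Binary.Construct.On as On
import Relation.Binary.Reasoning.Setoid
open import Relation.Binary.PropositionalEquality

private
  variable
    m : ℕ

-- Permutations

≢⇒<⊎> : {a b : Fin m} → a ≢ b → a F.< b ⊎ b F.< a
≢⇒<⊎> {a = a} {b} a≢b with <-cmp a b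
... | tri< a<b _ _ = inj₁ a<b
... | tri≈ _ a≡b _ = ⊥-elim (a≢b a≡b)
... | tri> _ _ b<a = inj₂ b<a

predecessor : (b : Fin m) → 0 ℕ.< toℕ b → Σ (Fin m) λ c → toℕ b ≡ suc (toℕ c)
predecessor b 0<b with toℕ b | toℕ<n b
... | suc c | c<m = fromℕ< (<⇒≤ c<m) , cong suc (sym (toℕ-fromℕ< (<⇒≤ c<m)))

successor : (a b : Fin m) → a F.< b → Σ (Fin m) λ c → toℕ c ≡ suc (toℕ a)
successor a b a<b = fromℕ< (≤-trans (s≤s a<b) (toℕ<n b)) , toℕ-fromℕ< _

⟨$⟩ʳ-injective : (w : Perm m) {p q : Fin m} → w ⟨$⟩ʳ p ≡ w ⟨$⟩ʳ q → p ≡ q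
⟨$⟩ʳ-injective w eq = trans (sym (P.inverseˡ w)) (trans (cong (w ⟨$⟩ˡ_) eq) (P.inverseˡ w))

≈-setoid : ℕ → Setoid 0ℓ 0ℓ
≈-setoid m = record
  { Carrier = Perm m
  ; _≈_ = _≈_
  ; isEquivalence = record
    { refl = λ _ → refl ; sym = λ u≈v k → sym (u≈v k) ; trans = λ u≈v v≈w k → trans (u≈v k) (v≈w k) } }

⁻¹-unique : (w v : Perm m) → (∀ k → w ⟨$⟩ʳ (v ⟨$⟩ʳ k) ≡ k) → w ⁻¹ ≈ v
⁻¹-unique w v wv≡id k = ⟨$⟩ʳ-injective w (trans (P.inverseʳ w) (sym (wv≡id k)))

⁻¹-cong : (u v : Perm m) → u ≈ v → u ⁻¹ ≈ v ⁻¹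
⁻¹-cong u v u≈v = ⁻¹-unique u (v ⁻¹) (λ k → trans (u≈v _) (P.inverseʳ v))

involution-⁻¹ : (x : Perm m) → x · x ≈ P.id → x ⁻¹ ≈ x
involution-⁻¹ x = ⁻¹-unique x x

fpf-resp-≈ : (z z′ : Perm m) → z ≈ z′ → IsFPFInvolution z → IsFPFInvolution z′
fpf-resp-≈ z z′ z≈z′ (invol , no-fix) =
  (λ k → trans (sym (z≈z′ _)) (trans (cong (z ⟨$⟩ʳ_) (sym (z≈z′ k))) (invol k))) ,
  (λ k fixed → no-fix k (trans (z≈z′ k) fixed))

RightDescent : Perm m → Set
RightDescent {m} w = Σ (Fin m) λ i → Σ (Fin m) λ j → toℕ j ≡ suc (toℕ i) × w ⟨$⟩ʳ j F.< w ⟨$⟩ʳ i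

Ascending : Perm m → Set
Ascending {m} w = ∀ (i j : Fin m) → toℕ j ≡ suc (toℕ i) → w ⟨$⟩ʳ i F.< w ⟨$⟩ʳ j

ascending⇒id : (w : Perm m) → Ascending w → w ≈ P.id
ascending⇒id {suc m} w asc k = toℕ-injective (≤-antisym (at-most k) (at-least k))
  where
  W : Fin (suc m) → ℕ
  W k = toℕ (w ⟨$⟩ʳ k)
  ascent : ∀ k → W (inject₁ k) ℕ.< W (suc k)
  ascent k = asc (inject₁ k) (suc k) (cong suc (sym (toℕ-inject₁ k)))
  at-least : ∀ k → toℕ k ℕ.≤ W k
  at-least = <-weakInduction (λ k → toℕ k ℕ.≤ W k) z≤n
    λ k ih → ≤-trans (s≤s (subst (ℕ._≤ W (inject₁ k)) (toℕ-inject₁ k) ih)) (ascent k)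
  at-most : ∀ k → W k ℕ.≤ toℕ k
  at-most = >-weakInduction (λ k → W k ℕ.≤ toℕ k)
    (subst (W (fromℕ m) ℕ.≤_) (sym (toℕ-fromℕ m)) (≤-pred (toℕ<n (w ⟨$⟩ʳ fromℕ m))))
    λ k ih → subst (W (inject₁ k) ℕ.≤_) (sym (toℕ-inject₁ k)) (≤-pred (≤-trans (ascent k) ih))

descent⊎id : (w : Perm m) → RightDescent w ⊎ w ≈ P.id
descent⊎id {m} w with any? (λ i → any? λ (j : Fin m) → (toℕ j ℕ.≟ suc (toℕ i)) ×-dec (w ⟨$⟩ʳ j <? w ⟨$⟩ʳ i))
... | yes (i , j , j≡1+i , wj<wi) = inj₁ (i , j , j≡1+i , wj<wi)
... | no no-descent = inj₂ (ascending⇒id w ascending)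
  where
  ascending : Ascending w
  ascending i j j≡1+i
    with ≢⇒<⊎> {a = w ⟨$⟩ʳ i} {w ⟨$⟩ʳ j} (1+n≢n ∘ trans (sym j≡1+i) ∘ cong toℕ ∘ sym ∘ ⟨$⟩ʳ-injective w)
  ... | inj₁ wi<wj = wi<wj
  ... | inj₂ wj<wi = ⊥-elim (no-descent (i , j , j≡1+i , wj<wi))

-- Length as a number of inversions

indicator : ∀ {a} {A : Set a} → Dec A → ℕ
indicator (yes _) = 1
indicator (no _) = 0

indicator-yes : ∀ {a} {A : Set a} → A → (d : Dec A) → indicator d ≡ 1
indicator-yes a (yes _) = refl
indicator-yes a (no ¬a) = ⊥-elim (¬a a)

indicator-no : ∀ {a} {A : Set a} → ¬ A → (d : Dec A) → indicator d ≡ 0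
indicator-no ¬a (yes a) = ⊥-elim (¬a a)
indicator-no ¬a (no _) = refl

indicator-cong : ∀ {a b} {A : Set a} {B : Set b} → A ⇔ B → (da : Dec A) (db : Dec B) →
                 indicator da ≡ indicator db
indicator-cong A⇔B (yes a) db = sym (indicator-yes (Equivalence.to A⇔B a) db)
indicator-cong A⇔B (no ¬a) db = sym (indicator-no (¬a ∘ Equivalence.from A⇔B) db)

Σ² : (Fin m → Fin m → ℕ) → ℕ
Σ² f = sum λ p → sum (f p)

sum-shift : ∀ {k} (p₀ : Fin k) {f g : Fin k → ℕ} {d e : ℕ} →
            (∀ p → p ≢ p₀ → f p ≡ g p) → f p₀ + d ≡ g p₀ + e → sum f + d ≡ sum g + e
sum-shift zero {f} {g} {d} {e} off eq = begin
  f zero + sum (f ∘ suc) + d  ≡⟨ xy∙z≈xz∙y (f zero) _ d ⟩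
  f zero + d + sum (f ∘ suc)  ≡⟨ cong₂ _+_ eq (sum-cong-≗ λ p → off (suc p) λ ()) ⟩
  g zero + e + sum (g ∘ suc)  ≡⟨ xy∙z≈xz∙y (g zero) _ e ⟨
  g zero + sum (g ∘ suc) + e  ∎
  where open ≡-Reasoning
sum-shift (suc p₀) {f} {g} {d} {e} off eq = begin
  f zero + sum (f ∘ suc) + d    ≡⟨ +-assoc (f zero) _ d ⟩
  f zero + (sum (f ∘ suc) + d)  ≡⟨ cong₂ _+_ (off zero λ ()) tail-shift ⟩
  g zero + (sum (g ∘ suc) + e)  ≡⟨ +-assoc (g zero) _ e ⟨
  g zero + sum (g ∘ suc) + e    ∎
  where
  open ≡-Reasoning
  tail-shift : sum (f ∘ suc) + d ≡ sum (g ∘ suc) + e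
  tail-shift = sum-shift p₀ (λ p p≢p₀ → off (suc p) (p≢p₀ ∘ Finₚ.suc-injective)) eq

Σ²-one-more : (p₀ q₀ : Fin m) {f g : Fin m → Fin m → ℕ} →
              (∀ p q → ¬ (p ≡ p₀ × q ≡ q₀) → f p q ≡ g p q) →
              f p₀ q₀ ≡ 1 → g p₀ q₀ ≡ 0 → Σ² f ≡ suc (Σ² g)
Σ²-one-more p₀ q₀ {f} {g} off f₀≡1 g₀≡0 = begin
  Σ² f        ≡⟨ +-comm 0 _ ⟩
  Σ² f + 0    ≡⟨ sum-shift p₀ off-row (sum-shift q₀ (λ q q≢q₀ → off p₀ q (q≢q₀ ∘ proj₂)) at-point) ⟩
  Σ² g + 1    ≡⟨ +-comm _ 1 ⟩
  suc (Σ² g)  ∎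
  where
  open ≡-Reasoning
  off-row : ∀ p → p ≢ p₀ → sum (f p) ≡ sum (g p)
  off-row p p≢p₀ = sum-cong-≗ λ q → off p q (p≢p₀ ∘ proj₁)
  at-point : f p₀ q₀ + 0 ≡ g p₀ q₀ + 1
  at-point = trans (+-comm _ 0) (trans f₀≡1 (cong (_+ 1) (sym g₀≡0)))

Σ²-permute : (π : Perm m) (f : Fin m → Fin m → ℕ) →
             Σ² f ≡ Σ² (λ p q → f (π ⟨$⟩ʳ p) (π ⟨$⟩ʳ q))
Σ²-permute π f = trans (sum-permute _ π) (sum-cong-≗ λ p → sum-permute (f (π ⟨$⟩ʳ p)) π)

module _ {a} {A : Set a} {P : Pred A a} (P? : Decidable P) where

  length-filter-tabulate : ∀ {k} (f : Fin k → A) →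
                           length (filter P? (tabulate f)) ≡ sum (indicator ∘ P? ∘ f)
  length-filter-tabulate {zero} f = refl
  length-filter-tabulate {suc k} f with P? (f zero)
  ... | yes _ = cong suc (length-filter-tabulate (f ∘ suc))
  ... | no _  = length-filter-tabulate (f ∘ suc)

  length-filter-++ : ∀ xs ys → length (filter P? (xs ++ ys)) ≡ length (filter P? xs) + length (filter P? ys)
  length-filter-++ xs ys = trans (cong length (filter-++ P? xs ys)) (length-++ (filter P? xs))

module _ {P : Pred (Fin m × Fin m) 0ℓ} (P? : Decidable P) where

  length-filter-square : ∀ {k} (f : Fin k → Fin m) →
    length (filter P? (cartesianProduct (tabulate f) (tabulate {n = m} (λ q → q)))) ≡
    sum (λ p → sum (λ q → indicator (P? (f p , q))))
  length-filter-square {zero} f = refl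
  length-filter-square {suc k} f =
    trans (length-filter-++ P? row rest) (cong₂ _+_ first-row (length-filter-square (f ∘ suc)))
    where
    row = map (f zero ,_) (tabulate {n = m} (λ q → q))
    rest = cartesianProduct (tabulate (f ∘ suc)) (tabulate {n = m} (λ q → q))
    first-row : length (filter P? row) ≡ sum (λ q → indicator (P? (f zero , q)))
    first-row = trans (cong (length ∘ filter P?) (map-tabulate (λ q → q) (f zero ,_)))
                      (length-filter-tabulate P? {m} (λ q → f zero , q))

inversion : Perm m → Fin m → Fin m → ℕ
inversion w p q = indicator ((p <? q) ×-dec (w ⟨$⟩ʳ q <? w ⟨$⟩ʳ p))

-- An opaque copy of ℓ, so that the list of inversions is never unfolded during type checking.
opaque
  len : Perm m → ℕ
  len = ℓ

  len-<⇒ℓ-< : (u v : Perm m) → len u ℕ.< len v → ℓ u ℕ.< ℓ v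
  len-<⇒ℓ-< u v lt = lt

  len-≤⇒ℓ-≤ : (u v : Perm m) → len u ℕ.≤ len v → ℓ u ℕ.≤ ℓ v
  len-≤⇒ℓ-≤ u v le = le

  ℓ-≤⇒len-≤ : (u v : Perm m) → ℓ u ℕ.≤ ℓ v → len u ℕ.≤ len v
  ℓ-≤⇒len-≤ u v le = le

  len≡Σ²inversion : (w : Perm m) → len w ≡ Σ² (inversion w)
  len≡Σ²inversion {m} w = length-filter-square {m} inversion? (λ p → p)
    where
    inversion? : Decidable λ (pq : Fin m × Fin m) → proj₁ pq F.< proj₂ pq × w ⟨$⟩ʳ proj₂ pq F.< w ⟨$⟩ʳ proj₁ pq
    inversion? (p , q) = (p <? q) ×-dec (w ⟨$⟩ʳ q <? w ⟨$⟩ʳ p)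

len-cong : (u v : Perm m) → u ≈ v → len u ≡ len v
len-cong {m} u v u≈v = begin
  len u             ≡⟨ len≡Σ²inversion u ⟩
  Σ² (inversion u)  ≡⟨ sum-cong-≗ (λ p → sum-cong-≗ λ q → indicator-cong (same p q) _ _) ⟩
  Σ² (inversion v)  ≡⟨ len≡Σ²inversion v ⟨
  len v             ∎
  where
  open ≡-Reasoning
  same : ∀ p q → (p F.< q × u ⟨$⟩ʳ q F.< u ⟨$⟩ʳ p) ⇔ (p F.< q × v ⟨$⟩ʳ q F.< v ⟨$⟩ʳ p)
  same p q = mk⇔ (λ (p<q , uq<up) → p<q , subst₂ F._<_ (u≈v q) (u≈v p) uq<up)
                 (λ (p<q , vq<vp) → p<q , subst₂ F._<_ (sym (u≈v q)) (sym (u≈v p)) vq<vp)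

len-id : len (P.id {m}) ≡ 0
len-id {m} = trans (len≡Σ²inversion (P.id {m})) (trans (sum-cong-≗ {m} row) (sum-replicate-zero m))
  where
  row : ∀ p → sum (inversion P.id p) ≡ 0
  row p = trans (sum-cong-≗ {m} λ q → indicator-no (λ (p<q , q<p) → <-asym p<q q<p) _)
                (sum-replicate-zero m)

len-⁻¹ : (w : Perm m) → len (w ⁻¹) ≡ len w
len-⁻¹ {m} w = begin
  len (w ⁻¹)                                           ≡⟨ len≡Σ²inversion (w ⁻¹) ⟩
  Σ² (inversion (w ⁻¹))                                ≡⟨ Σ²-permute w (inversion (w ⁻¹)) ⟩
  Σ² (λ p q → inversion (w ⁻¹) (w ⟨$⟩ʳ p) (w ⟨$⟩ʳ q))  ≡⟨ sum-cong-≗ (λ p → sum-cong-≗ λ q →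
                                                           indicator-cong (flipped p q) _ _) ⟩
  sum (λ p → sum (λ q → inversion w q p))              ≡⟨ ∑-comm (λ p q → inversion w q p) ⟩
  Σ² (inversion w)                                     ≡⟨ len≡Σ²inversion w ⟨
  len w                                                ∎
  where
  open ≡-Reasoning
  flipped : ∀ p q → (w ⟨$⟩ʳ p F.< w ⟨$⟩ʳ q × (w ⁻¹) ⟨$⟩ʳ (w ⟨$⟩ʳ q) F.< (w ⁻¹) ⟨$⟩ʳ (w ⟨$⟩ʳ p))
                  ⇔ (q F.< p × w ⟨$⟩ʳ p F.< w ⟨$⟩ʳ q)
  flipped p q = mk⇔ (λ (wp<wq , q<p) → subst₂ F._<_ (P.inverseˡ w) (P.inverseˡ w) q<p , wp<wq)
                    (λ (q<p , wp<wq) → wp<wq , subst₂ F._<_ (sym (P.inverseˡ w)) (sym (P.inverseˡ w)) q<p)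

len-rec : (P : Perm m → Set) → (∀ w → (∀ {v} → len v ℕ.< len w → P v) → P w) → ∀ w → P w
len-rec {m} P = All.wfRec (On.wellFounded (len {m}) <-wellFounded) 0ℓ P

-- Visible descents, 321 patterns and nestings of fixed-point-free involutions

VisibleDescent : Perm m → Fin m → Fin m → Set
VisibleDescent x i j = x ⟨$⟩ʳ j F.< x ⟨$⟩ʳ i × x ⟨$⟩ʳ i ≢ j

HasVisibleDescent : Perm m → Set
HasVisibleDescent {m} x = Σ (Fin m) λ i → Σ (Fin m) λ j → toℕ j ≡ suc (toℕ i) × VisibleDescent x i j

Pattern321 : Perm m → Set
Pattern321 {m} w = Σ (Fin m) λ i → Σ (Fin m) λ j → Σ (Fin m) λ k →
  (i F.< j) × (j F.< k) × (w ⟨$⟩ʳ j F.< w ⟨$⟩ʳ i) × (w ⟨$⟩ʳ k F.< w ⟨$⟩ʳ j)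

HasNesting : Perm m → Set
HasNesting {m} x = Σ (Fin m) λ a → Σ (Fin m) λ a′ →
  a F.< a′ × a′ F.< x ⟨$⟩ʳ a′ × x ⟨$⟩ʳ a′ F.< x ⟨$⟩ʳ a

hasNesting? : (x : Perm m) → Dec (HasNesting x)
hasNesting? x = any? λ a → any? λ a′ → (a <? a′) ×-dec ((a′ <? x ⟨$⟩ʳ a′) ×-dec (x ⟨$⟩ʳ a′ <? x ⟨$⟩ʳ a))

HasNesting-resp-≈ : (x x′ : Perm m) → x ≈ x′ → HasNesting x → HasNesting x′
HasNesting-resp-≈ x x′ x≈x′ (a , a′ , a<a′ , a′<xa′ , xa′<xa) =
  a , a′ , a<a′ , subst (a′ F.<_) (x≈x′ a′) a′<xa′ , subst₂ F._<_ (x≈x′ a′) (x≈x′ a) xa′<xa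

pattern321⇒nesting : (x : Perm m) → IsFPFInvolution x → Pattern321 x → HasNesting x
pattern321⇒nesting x (invol , no-fix) (p , q , r , p<q , q<r , xq<xp , xr<xq)
  with ≢⇒<⊎> (no-fix q)
... | inj₂ q<xq = p , q , p<q , q<xq , xq<xp
... | inj₁ xq<q = x ⟨$⟩ʳ r , x ⟨$⟩ʳ q , xr<xq , subst (x ⟨$⟩ʳ q F.<_) (sym (invol q)) xq<q ,
                  subst₂ F._<_ (sym (invol q)) (sym (invol r)) q<r

pairSwap-≤ : ∀ {k} (a : Fin k) → toℕ (pairSwap a) ℕ.≤ suc (toℕ a)
pairSwap-≤ {suc zero} zero = z≤n
pairSwap-≤ {suc (suc k)} zero = s≤s z≤n
pairSwap-≤ {suc (suc k)} (suc zero) = z≤n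
pairSwap-≤ {suc (suc k)} (suc (suc a)) = s≤s (s≤s (pairSwap-≤ a))

pairSwap-moved : ∀ {k} (a : Fin k) → pairSwap a ≢ a →
                 toℕ (pairSwap a) ≡ suc (toℕ a) ⊎ toℕ a ≡ suc (toℕ (pairSwap a))
pairSwap-moved {suc zero} zero moved = ⊥-elim (moved refl)
pairSwap-moved {suc (suc k)} zero _ = inj₁ refl
pairSwap-moved {suc (suc k)} (suc zero) _ = inj₂ refl
pairSwap-moved {suc (suc k)} (suc (suc a)) moved =
  ⊎-map (cong (ℕ.suc ∘ ℕ.suc)) (cong (ℕ.suc ∘ ℕ.suc)) (pairSwap-moved a (moved ∘ cong (F.suc ∘ F.suc)))

pairSwap-fixed⇒odd : ∀ {k} (a : Fin k) → pairSwap a ≡ a → ∃ λ h → k ≡ suc (2 * h)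
pairSwap-fixed⇒odd {suc zero} zero _ = 0 , refl
pairSwap-fixed⇒odd {suc (suc k)} (suc (suc a)) fixed with pairSwap-fixed⇒odd a (Finₚ.suc-injective (Finₚ.suc-injective fixed))
... | h , k≡1+2h = suc h , cong (ℕ.suc ∘ ℕ.suc) (trans k≡1+2h (sym (+-suc h (h + 0))))

pairSwap-closed : ∀ {k} (a : Fin k) → toℕ (pairSwap a) ≡ suc (toℕ a) →
                  ∀ (b : Fin k) → toℕ b ℕ.< toℕ a → toℕ (pairSwap b) ℕ.< toℕ a
pairSwap-closed {suc (suc k)} (suc (suc a)) _ zero _ = s≤s (s≤s z≤n)
pairSwap-closed {suc (suc k)} (suc (suc a)) _ (suc zero) _ = s≤s z≤n
pairSwap-closed {suc (suc k)} (suc (suc a)) lower (suc (suc b)) (s≤s (s≤s b<a)) =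
  s≤s (s≤s (pairSwap-closed a (suc-injective (suc-injective lower)) b b<a))

module _ (n : ℕ) where

  private
    W : Fin (2 * n) → Fin (2 * n)
    W k = wfpf n ⟨$⟩ʳ k

  wfpf-fpf : IsFPFInvolution (wfpf n)
  wfpf-fpf = (λ k → pairSwap-invol k) ,
             λ k fixed → let h , 2n≡1+2h = pairSwap-fixed⇒odd k fixed in even≢odd n h 2n≡1+2h

  wfpf-noNesting : ¬ HasNesting (wfpf n)
  wfpf-noNesting (a , a′ , a<a′ , a′<Wa′ , Wa′<Wa) =
    <-irrefl refl (≤-trans (s≤s (<-trans a<a′ a′<Wa′)) (≤-trans Wa′<Wa (pairSwap-≤ a)))

  wfpf-moved : (k : Fin (2 * n)) → toℕ (W k) ≡ suc (toℕ k) ⊎ toℕ k ≡ suc (toℕ (W k))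
  wfpf-moved k = pairSwap-moved k (proj₂ wfpf-fpf k)

-- By induction on a, x agrees with w_fpf below a.  When a is the smaller end of an arc of
-- w_fpf, x maps [a, 2n) into itself, and x(a) > a + 1 would make (x(a) - 1, x(a)) a visible descent.
module WithoutVisibleDescent {n} (x : Perm (2 * n)) (x-fpf : IsFPFInvolution x)
  (no-vd : ∀ i j → toℕ j ≡ suc (toℕ i) → ¬ VisibleDescent x i j) where

  private
    X W : Fin (2 * n) → Fin (2 * n)
    X k = x ⟨$⟩ʳ k
    W k = wfpf n ⟨$⟩ʳ k

  x-invol : ∀ k → X (X k) ≡ k
  x-invol = proj₁ x-fpf

  module _ (a : ℕ) (agree-below : ∀ k → toℕ k ℕ.< a → X k ≡ W k) (k : Fin (2 * n)) (k≡a : toℕ k ≡ a) where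

    agree-at-upper : toℕ k ≡ suc (toℕ (W k)) → X k ≡ W k
    agree-at-upper upper = begin
      X k          ≡⟨ cong X (pairSwap-invol k) ⟨
      X (W (W k))  ≡⟨ cong X (agree-below (W k) (subst (toℕ (W k) ℕ.<_) k≡a (≤-reflexive (sym upper)))) ⟨
      X (X (W k))  ≡⟨ x-invol (W k) ⟩
      W k          ∎
      where open ≡-Reasoning

    module _ (lower : toℕ (W k) ≡ suc (toℕ k)) where

      stays-above : ∀ p → a ℕ.≤ toℕ p → a ℕ.≤ toℕ (X p)
      stays-above p a≤p with a ℕ.≤? toℕ (X p)
      ... | yes a≤xp = a≤xp
      ... | no a≰xp = ⊥-elim (<⇒≱ p<a a≤p)
        where
        xp<a = ≰⇒> a≰xp
        p<a : toℕ p ℕ.< a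
        p<a = subst (λ q → toℕ q ℕ.< a) (trans (sym (agree-below (X p) xp<a)) (x-invol p))
                (subst (toℕ (W (X p)) ℕ.<_) k≡a (pairSwap-closed k lower (X p) (subst (toℕ (X p) ℕ.<_) (sym k≡a) xp<a)))

      above : a ℕ.< toℕ (X k)
      above = ≤∧≢⇒< (stays-above k (≤-reflexive (sym k≡a)))
                    λ a≡xk → proj₂ x-fpf k (toℕ-injective (trans (sym a≡xk) (sym k≡a)))

      not-beyond : ¬ (suc a ℕ.< toℕ (X k))
      not-beyond 1+a<xk = no-vd I (X k) xk≡1+I (descent , xI≢xk)
        where
        I = proj₁ (predecessor (X k) (≤-trans (s≤s z≤n) 1+a<xk))
        xk≡1+I : toℕ (X k) ≡ suc (toℕ I)
        xk≡1+I = proj₂ (predecessor (X k) (≤-trans (s≤s z≤n) 1+a<xk))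
        a<I : a ℕ.< toℕ I
        a<I = ≤-pred (subst (suc a ℕ.<_) xk≡1+I 1+a<xk)
        xI≢xk : X I ≢ X k
        xI≢xk xI≡xk = <-irrefl (trans (sym k≡a) (cong toℕ (⟨$⟩ʳ-injective x (sym xI≡xk)))) a<I
        xI≢k : X I ≢ k
        xI≢k xI≡k = 1+n≢n (trans (sym xk≡1+I) (cong toℕ (trans (cong X (sym xI≡k)) (x-invol I))))
        descent : X (X k) F.< X I
        descent = subst (λ q → toℕ q ℕ.< toℕ (X I)) (sym (x-invol k))
                    (subst (ℕ._< toℕ (X I)) (sym k≡a)
                      (≤∧≢⇒< (stays-above I (<⇒≤ a<I)) λ a≡xI → xI≢k (toℕ-injective (trans (sym a≡xI) (sym k≡a)))))

      agree-at-lower : X k ≡ W k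
      agree-at-lower = toℕ-injective (trans (sym (≤∧≮⇒≡ above not-beyond)) (trans (cong suc (sym k≡a)) (sym lower)))

  agree : ∀ a k → toℕ k ℕ.< a → X k ≡ W k
  agree (suc a) k k<1+a with m≤n⇒m<n∨m≡n (≤-pred k<1+a)
  ... | inj₁ k<a = agree a k k<a
  ... | inj₂ k≡a = [ agree-at-lower a (agree a) k k≡a , agree-at-upper a (agree a) k k≡a ]′ (wfpf-moved n k)

  x≈wfpf : x ≈ wfpf n
  x≈wfpf k = agree (suc (toℕ k)) k ≤-refl

visibleDescent⊎wfpf : ∀ {n} (x : Perm (2 * n)) → IsFPFInvolution x → HasVisibleDescent x ⊎ x ≈ wfpf n
visibleDescent⊎wfpf {n} x x-fpf
  with any? (λ i → any? λ (j : Fin (2 * n)) →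
         (toℕ j ℕ.≟ suc (toℕ i)) ×-dec ((x ⟨$⟩ʳ j <? x ⟨$⟩ʳ i) ×-dec ¬? (x ⟨$⟩ʳ i ≟ j)))
... | yes (i , j , j≡1+i , vd) = inj₁ (i , j , j≡1+i , vd)
... | no no-vd = inj₂ (WithoutVisibleDescent.x≈wfpf {n} x x-fpf λ i j j≡1+i vd → no-vd (i , j , j≡1+i , vd))

-- Adjacent transpositions

module Adjacent (i j : Fin m) (j≡1+i : toℕ j ≡ suc (toℕ i)) where

  s : Perm m
  s = transpose i j

  τ : Fin m → Fin m
  τ k = s ⟨$⟩ʳ k

  s-simple : IsSimple s
  s-simple = i , j , j≡1+i , λ _ → refl

  i<j : i F.< j
  i<j = ≤-reflexive (sym j≡1+i)

  i≢j : i ≢ j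
  i≢j = <⇒≢ i<j

  nothing-between : (k : Fin m) → i F.< k → k F.< j → ⊥
  nothing-between k i<k k<j = <⇒≱ k<j (subst (ℕ._≤ toℕ k) (sym j≡1+i) i<k)

  τ-i : τ i ≡ j
  τ-i with i ≟ i
  ... | yes _ = refl
  ... | no i≢i = ⊥-elim (i≢i refl)

  τ-j : τ j ≡ i
  τ-j with j ≟ i
  ... | yes refl = refl
  ... | no _ with j ≟ j
  ...   | yes _ = refl
  ...   | no j≢j = ⊥-elim (j≢j refl)

  τ-other : ∀ k → k ≢ i → k ≢ j → τ k ≡ k
  τ-other k k≢i k≢j with k ≟ i
  ... | yes k≡i = ⊥-elim (k≢i k≡i)
  ... | no _ with k ≟ j
  ...   | yes k≡j = ⊥-elim (k≢j k≡j)
  ...   | no _ = refl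

  τ-involutive : ∀ k → τ (τ k) ≡ k
  τ-involutive k = by-cases (k ≟ i) (k ≟ j)
    where
    by-cases : Dec (k ≡ i) → Dec (k ≡ j) → τ (τ k) ≡ k
    by-cases (yes refl) _ = trans (cong τ τ-i) τ-j
    by-cases (no _) (yes refl) = trans (cong τ τ-j) τ-i
    by-cases (no k≢i) (no k≢j) = trans (cong τ (τ-other k k≢i k≢j)) (τ-other k k≢i k≢j)

  τ-injective : ∀ {a b} → τ a ≡ τ b → a ≡ b
  τ-injective = ⟨$⟩ʳ-injective s

  τ-mono : ∀ a b → a F.< b → ¬ (a ≡ i × b ≡ j) → τ a F.< τ b
  τ-mono a b a<b not-ij = by-cases (a ≟ i) (a ≟ j) (b ≟ i) (b ≟ j)
    where
    by-cases : Dec (a ≡ i) → Dec (a ≡ j) → Dec (b ≡ i) → Dec (b ≡ j) → τ a F.< τ b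
    by-cases (yes refl) _ (yes refl) _ = ⊥-elim (<-irrefl refl a<b)
    by-cases (yes refl) _ (no _) (yes refl) = ⊥-elim (not-ij (refl , refl))
    by-cases (yes refl) _ (no b≢i) (no b≢j) rewrite τ-i | τ-other b b≢i b≢j =
      [ (λ j<b → j<b) , (λ b<j → ⊥-elim (nothing-between b a<b b<j)) ]′ (≢⇒<⊎> (b≢j ∘ sym))
    by-cases (no _) (yes refl) (yes refl) _ = ⊥-elim (<-asym a<b i<j)
    by-cases (no _) (yes refl) (no _) (yes refl) = ⊥-elim (<-irrefl refl a<b)
    by-cases (no _) (yes refl) (no b≢i) (no b≢j) rewrite τ-j | τ-other b b≢i b≢j = <-trans i<j a<b
    by-cases (no a≢i) (no a≢j) (yes refl) _ rewrite τ-i | τ-other a a≢i a≢j = <-trans a<b i<j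
    by-cases (no a≢i) (no a≢j) (no _) (yes refl) rewrite τ-j | τ-other a a≢i a≢j =
      [ (λ a<i → a<i) , (λ i<a → ⊥-elim (nothing-between a i<a a<b)) ]′ (≢⇒<⊎> a≢i)
    by-cases (no a≢i) (no a≢j) (no b≢i) (no b≢j) rewrite τ-other a a≢i a≢j | τ-other b b≢i b≢j = a<b

  τ-mono⁻ : ∀ a b → τ a F.< τ b → ¬ (a ≡ j × b ≡ i) → a F.< b
  τ-mono⁻ a b τa<τb not-ji = subst₂ F._<_ (τ-involutive a) (τ-involutive b)
    (τ-mono (τ a) (τ b) τa<τb λ (τa≡i , τb≡j) →
      not-ji (τ-injective (trans τa≡i (sym τ-j)) , τ-injective (trans τb≡j (sym τ-i))))

  ·s·s : (u : Perm m) → (u · s) · s ≈ u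
  ·s·s u k = cong (u ⟨$⟩ʳ_) (τ-involutive k)

  s·s· : (u : Perm m) → s · (s · u) ≈ u
  s·s· u k = τ-involutive (u ⟨$⟩ʳ k)

  len-s·-up : (w : Perm m) {p q : Fin m} → w ⟨$⟩ʳ p ≡ i → w ⟨$⟩ʳ q ≡ j → p F.< q →
            len (s · w) ≡ suc (len w)
  len-s·-up w {p} {q} wp≡i wq≡j p<q = begin
    len (s · w)             ≡⟨ len≡Σ²inversion (s · w) ⟩
    Σ² (inversion (s · w))  ≡⟨ Σ²-one-more p q off-pq at-pq (indicator-no (λ (_ , wq<wp) → <-asym wq<wp wp<wq) _) ⟩
    suc (Σ² (inversion w))  ≡⟨ cong suc (len≡Σ²inversion w) ⟨
    suc (len w)             ∎
    where
    open ≡-Reasoning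
    wp<wq : w ⟨$⟩ʳ p F.< w ⟨$⟩ʳ q
    wp<wq = subst₂ F._<_ (sym wp≡i) (sym wq≡j) i<j
    at-pq : inversion (s · w) p q ≡ 1
    at-pq = indicator-yes (p<q , subst₂ F._<_ (sym (trans (cong τ wq≡j) τ-j)) (sym (trans (cong τ wp≡i) τ-i)) i<j) _
    off-pq : ∀ a b → ¬ (a ≡ p × b ≡ q) → inversion (s · w) a b ≡ inversion w a b
    off-pq a b not-pq = indicator-cong (mk⇔ to from) _ _
      where
      to : a F.< b × τ (w ⟨$⟩ʳ b) F.< τ (w ⟨$⟩ʳ a) → a F.< b × w ⟨$⟩ʳ b F.< w ⟨$⟩ʳ a
      to (a<b , lt) = a<b , τ-mono⁻ _ _ lt λ (wb≡j , wa≡i) →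
        not-pq (⟨$⟩ʳ-injective w (trans wa≡i (sym wp≡i)) , ⟨$⟩ʳ-injective w (trans wb≡j (sym wq≡j)))
      from : a F.< b × w ⟨$⟩ʳ b F.< w ⟨$⟩ʳ a → a F.< b × τ (w ⟨$⟩ʳ b) F.< τ (w ⟨$⟩ʳ a)
      from (a<b , lt) = a<b , τ-mono _ _ lt λ (wb≡i , wa≡j) →
        <-asym a<b (subst₂ F._<_ (⟨$⟩ʳ-injective w (trans wp≡i (sym wb≡i)))
                                  (⟨$⟩ʳ-injective w (trans wq≡j (sym wa≡j))) p<q)

  len-s·-down : (w : Perm m) {p q : Fin m} → w ⟨$⟩ʳ p ≡ i → w ⟨$⟩ʳ q ≡ j → q F.< p →
              len w ≡ suc (len (s · w))
  len-s·-down w wp≡i wq≡j q<p = trans (sym (len-cong (s · (s · w)) w (s·s· w)))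
    (len-s·-up (s · w) (trans (cong τ wq≡j) τ-j) (trans (cong τ wp≡i) τ-i) q<p)

  ·s-⁻¹ : (w : Perm m) → (w · s) ⁻¹ ≈ s · w ⁻¹
  ·s-⁻¹ w = ⁻¹-unique (w · s) (s · w ⁻¹) λ k → trans (cong (w ⟨$⟩ʳ_) (τ-involutive _)) (P.inverseʳ w)

  len-·s-up : (w : Perm m) → w ⟨$⟩ʳ i F.< w ⟨$⟩ʳ j → len (w · s) ≡ suc (len w)
  len-·s-up w wi<wj = begin
    len (w · s)       ≡⟨ len-⁻¹ (w · s) ⟨
    len ((w · s) ⁻¹)  ≡⟨ len-cong ((w · s) ⁻¹) (s · w ⁻¹) (·s-⁻¹ w) ⟩
    len (s · w ⁻¹)    ≡⟨ len-s·-up (w ⁻¹) (P.inverseˡ w) (P.inverseˡ w) wi<wj ⟩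
    suc (len (w ⁻¹))  ≡⟨ cong suc (len-⁻¹ w) ⟩
    suc (len w)       ∎
    where open ≡-Reasoning

  len-·s-down : (w : Perm m) → w ⟨$⟩ʳ j F.< w ⟨$⟩ʳ i → len w ≡ suc (len (w · s))
  len-·s-down w wj<wi = trans (sym (len-cong ((w · s) · s) w (·s·s w)))
    (len-·s-up (w · s) (subst₂ F._<_ (cong (w ⟨$⟩ʳ_) (sym τ-i)) (cong (w ⟨$⟩ʳ_) (sym τ-j)) wj<wi))

  ·s-cancel : (u u′ : Perm m) → u · s ≈ u′ · s → u ≈ u′
  ·s-cancel u u′ us≈u′s k = trans (cong (u ⟨$⟩ʳ_) (sym (τ-involutive k)))
                                  (trans (us≈u′s (τ k)) (cong (u′ ⟨$⟩ʳ_) (τ-involutive k)))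

  conj : Perm m → Perm m
  conj z = s · (z · s)

  conj-cong : ∀ z z′ → z ≈ z′ → conj z ≈ conj z′
  conj-cong z z′ z≈z′ k = cong τ (z≈z′ (τ k))

  conj-involutive : ∀ z → conj (conj z) ≈ z
  conj-involutive z k = trans (τ-involutive _) (cong (z ⟨$⟩ʳ_) (τ-involutive k))

  module _ (z : Perm m) (z-fpf : IsFPFInvolution z) where

    private
      Z : Fin m → Fin m
      Z k = z ⟨$⟩ʳ k

    conj-fpf : IsFPFInvolution (conj z)
    conj-fpf = (λ k → trans (cong (τ ∘ Z) (τ-involutive _)) (trans (cong τ (proj₁ z-fpf _)) (τ-involutive k))) ,
               λ k fixed → proj₂ z-fpf (τ k) (τ-injective (trans fixed (sym (τ-involutive k))))

    τ-mono-fpf : Z i F.< Z j → τ (Z i) F.< τ (Z j)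
    τ-mono-fpf zi<zj = τ-mono (Z i) (Z j) zi<zj λ (zi≡i , _) → proj₂ z-fpf i zi≡i

    len-s·[z·s]-up : Z i F.< Z j → len (conj z) ≡ suc (len (z · s))
    len-s·[z·s]-up zi<zj = len-s·-up (z · s) (trans (cong Z (τ-involutive _)) (proj₁ z-fpf i))
                                              (trans (cong Z (τ-involutive _)) (proj₁ z-fpf j)) (τ-mono-fpf zi<zj)

    len-conj-up : Z i F.< Z j → len (conj z) ≡ suc (suc (len z))
    len-conj-up zi<zj = trans (len-s·[z·s]-up zi<zj) (cong suc (len-·s-up z zi<zj))

    conj-visible : Z i F.< Z j → VisibleDescent (conj z) i j
    conj-visible zi<zj = subst₂ (λ a b → τ (Z a) F.< τ (Z b)) (sym τ-j) (sym τ-i) (τ-mono-fpf zi<zj) ,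
                         λ τzj≡j → <-asym i<j (subst₂ F._<_ (zi≡j τzj≡j) (zj≡i τzj≡j) zi<zj)
      where
      zj≡i : τ (Z (τ i)) ≡ j → Z j ≡ i
      zj≡i e = trans (cong Z (sym τ-i)) (τ-injective (trans e (sym τ-i)))
      zi≡j : τ (Z (τ i)) ≡ j → Z i ≡ j
      zi≡j e = trans (cong Z (sym (zj≡i e))) (proj₁ z-fpf j)

  module _ (x : Perm m) (x-fpf : IsFPFInvolution x) (vd : VisibleDescent x i j) where

    conj-ascent : conj x ⟨$⟩ʳ i F.< conj x ⟨$⟩ʳ j
    conj-ascent = subst₂ (λ a b → τ (x ⟨$⟩ʳ a) F.< τ (x ⟨$⟩ʳ b)) (sym τ-i) (sym τ-j)
                    (τ-mono (x ⟨$⟩ʳ j) (x ⟨$⟩ʳ i) (proj₁ vd) λ (_ , xi≡j) → proj₂ vd xi≡j)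

    len-visible : len x ≡ suc (suc (len (conj x)))
    len-visible = trans (sym (len-cong (conj (conj x)) x (conj-involutive x)))
                        (len-conj-up (conj x) (conj-fpf x x-fpf) conj-ascent)

  nesting-conj : ∀ x → VisibleDescent x i j → ∀ a a′ →
                 a F.< a′ → a′ F.< x ⟨$⟩ʳ a′ → x ⟨$⟩ʳ a′ F.< x ⟨$⟩ʳ a →
                 ¬ (a ≡ i × a′ ≡ j) → ¬ (x ⟨$⟩ʳ a′ ≡ i × x ⟨$⟩ʳ a ≡ j) → HasNesting (conj x)
  nesting-conj x vd a a′ a<a′ a′<xa′ xa′<xa not-ij not-x-ij =
    τ a , τ a′ , τ-mono a a′ a<a′ not-ij ,
    subst (λ b → τ a′ F.< τ (x ⟨$⟩ʳ b)) (sym (τ-involutive a′))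
      (τ-mono a′ (x ⟨$⟩ʳ a′) a′<xa′ λ (a′≡i , xa′≡j) → proj₂ vd (subst (λ b → x ⟨$⟩ʳ b ≡ j) a′≡i xa′≡j)) ,
    subst₂ (λ b c → τ (x ⟨$⟩ʳ b) F.< τ (x ⟨$⟩ʳ c)) (sym (τ-involutive a′)) (sym (τ-involutive a))
      (τ-mono _ _ xa′<xa not-x-ij)

  module _ (x : Perm m) (x-fpf : IsFPFInvolution x) (avoids : ¬ Pattern321 x) (vd : VisibleDescent x i j) where

    private
      X : Fin m → Fin m
      X k = x ⟨$⟩ʳ k

    xj<i : X j F.< i
    xj<i with ≢⇒<⊎> (proj₂ x-fpf j)
    ... | inj₂ j<xj = ⊥-elim (avoids (i , j , X j , i<j , j<xj , proj₁ vd , subst (F._< X j) (sym (proj₁ x-fpf j)) j<xj))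
    ... | inj₁ xj<j with ≢⇒<⊎> {a = X j} {i} (λ xj≡i → proj₂ vd (trans (cong X (sym xj≡i)) (proj₁ x-fpf j)))
    ...   | inj₁ xj<i = xj<i
    ...   | inj₂ i<xj = ⊥-elim (nothing-between (X j) i<xj xj<j)

    j<xi : j F.< X i
    j<xi with ≢⇒<⊎> (proj₂ x-fpf i)
    ... | inj₁ xi<i = ⊥-elim (avoids (X j , X i , i , proj₁ vd , xi<i ,
                        subst₂ F._<_ (sym (proj₁ x-fpf i)) (sym (proj₁ x-fpf j)) i<j ,
                        subst (X i F.<_) (sym (proj₁ x-fpf i)) xi<i))
    ... | inj₂ i<xi with ≢⇒<⊎> {a = j} {X i} (proj₂ vd ∘ sym)
    ...   | inj₁ j<xi = j<xi
    ...   | inj₂ xi<j = ⊥-elim (nothing-between (X i) i<xi xi<j)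

    avoids-conj : ¬ Pattern321 (conj x)
    avoids-conj (p , q , r , p<q , q<r , yq<yp , yr<yq) =
      avoids (τ p , τ q , τ r , order p<q yq<yp , order q<r yr<yq , value p<q yq<yp , value q<r yr<yq)
      where
      Y : Fin m → Fin m
      Y k = conj x ⟨$⟩ʳ k
      xj-fixed : τ (X j) ≡ X j
      xj-fixed = τ-other (X j) (<⇒≢ xj<i) (<⇒≢ (<-trans xj<i i<j))
      xi-fixed : τ (X i) ≡ X i
      xi-fixed = τ-other (X i) (<⇒≢ (<-trans i<j j<xi) ∘ sym) (<⇒≢ j<xi ∘ sym)
      Yi : Y i ≡ X j
      Yi = trans (cong (τ ∘ X) τ-i) xj-fixed
      Yj : Y j ≡ X i
      Yj = trans (cong (τ ∘ X) τ-j) xi-fixed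
      order : ∀ {a b} → a F.< b → Y b F.< Y a → τ a F.< τ b
      order {a} {b} a<b yb<ya = τ-mono a b a<b λ (a≡i , b≡j) →
        <-asym (subst₂ F._<_ (trans (cong Y b≡j) Yj) (trans (cong Y a≡i) Yi) yb<ya) (proj₁ vd)
      value : ∀ {a b} → a F.< b → Y b F.< Y a → X (τ b) F.< X (τ a)
      value {a} {b} a<b yb<ya = τ-mono⁻ (X (τ b)) (X (τ a)) yb<ya λ (xτb≡j , xτa≡i) →
        <-asym (subst₂ F._<_ (position a xτa≡i xi-fixed) (position b xτb≡j xj-fixed) a<b) (proj₁ vd)
        where
        position : ∀ c {d} → X (τ c) ≡ d → τ (X d) ≡ X d → c ≡ X d
        position c {d} xτc≡d fixed = trans (sym (τ-involutive c))
          (trans (cong τ (trans (sym (proj₁ x-fpf (τ c))) (cong X xτc≡d))) fixed)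

module TwoAdjacent (i j : Fin m) (j≡1+i : toℕ j ≡ suc (toℕ i))
                   (i′ j′ : Fin m) (j′≡1+i′ : toℕ j′ ≡ suc (toℕ i′)) where

  module A = Adjacent i j j≡1+i
  module A′ = Adjacent i′ j′ j′≡1+i′

  τ-commute : i ≢ i′ → i ≢ j′ → j ≢ i′ → j ≢ j′ → ∀ k → A.τ (A′.τ k) ≡ A′.τ (A.τ k)
  τ-commute i≢i′ i≢j′ j≢i′ j≢j′ k = by-cases (k ≟ i) (k ≟ j) (k ≟ i′) (k ≟ j′)
    where
    open ≡-Reasoning
    by-cases : Dec (k ≡ i) → Dec (k ≡ j) → Dec (k ≡ i′) → Dec (k ≡ j′) → A.τ (A′.τ k) ≡ A′.τ (A.τ k)
    by-cases (yes refl) _ _ _ = begin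
      A.τ (A′.τ i)  ≡⟨ cong A.τ (A′.τ-other i i≢i′ i≢j′) ⟩
      A.τ i         ≡⟨ A.τ-i ⟩
      j             ≡⟨ A′.τ-other j j≢i′ j≢j′ ⟨
      A′.τ j        ≡⟨ cong A′.τ A.τ-i ⟨
      A′.τ (A.τ i)  ∎
    by-cases (no _) (yes refl) _ _ = begin
      A.τ (A′.τ j)  ≡⟨ cong A.τ (A′.τ-other j j≢i′ j≢j′) ⟩
      A.τ j         ≡⟨ A.τ-j ⟩
      i             ≡⟨ A′.τ-other i i≢i′ i≢j′ ⟨
      A′.τ i        ≡⟨ cong A′.τ A.τ-j ⟨
      A′.τ (A.τ j)  ∎
    by-cases (no k≢i) (no k≢j) (yes refl) _ = begin
      A.τ (A′.τ i′)  ≡⟨ cong A.τ A′.τ-i ⟩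
      A.τ j′         ≡⟨ A.τ-other j′ (i≢j′ ∘ sym) (j≢j′ ∘ sym) ⟩
      j′             ≡⟨ A′.τ-i ⟨
      A′.τ i′        ≡⟨ cong A′.τ (A.τ-other i′ k≢i k≢j) ⟨
      A′.τ (A.τ i′)  ∎
    by-cases (no k≢i) (no k≢j) (no _) (yes refl) = begin
      A.τ (A′.τ j′)  ≡⟨ cong A.τ A′.τ-j ⟩
      A.τ i′         ≡⟨ A.τ-other i′ (i≢i′ ∘ sym) (j≢i′ ∘ sym) ⟩
      i′             ≡⟨ A′.τ-j ⟨
      A′.τ j′        ≡⟨ cong A′.τ (A.τ-other j′ k≢i k≢j) ⟨
      A′.τ (A.τ j′)  ∎
    by-cases (no k≢i) (no k≢j) (no k≢i′) (no k≢j′) = begin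
      A.τ (A′.τ k)  ≡⟨ cong A.τ (A′.τ-other k k≢i′ k≢j′) ⟩
      A.τ k         ≡⟨ A.τ-other k k≢i k≢j ⟩
      k             ≡⟨ A′.τ-other k k≢i′ k≢j′ ⟨
      A′.τ k        ≡⟨ cong A′.τ (A.τ-other k k≢i k≢j) ⟨
      A′.τ (A.τ k)  ∎

  module _ (x : Perm m) (x-fpf : IsFPFInvolution x) (avoids : ¬ Pattern321 x)
           (vd : VisibleDescent x i j) (vd′ : VisibleDescent x i′ j′) where

    private
      X : Fin m → Fin m
      X k = x ⟨$⟩ʳ k

    visible-apart : i′ ≢ j
    visible-apart i′≡j = <-irrefl refl
      (<-trans (<-trans i<j′ (subst (λ b → j′ F.< X b) i′≡j (A′.j<xi x x-fpf avoids vd′)))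
                    (A.xj<i x x-fpf avoids vd))
      where
      i<j′ : i F.< j′
      i<j′ = subst (toℕ i ℕ.<_) (sym (trans j′≡1+i′ (trans (cong (ℕ.suc ∘ toℕ) i′≡j) (cong ℕ.suc j≡1+i))))
                   (s≤s (n≤1+n _))

    visible-persists : i ≢ i′ → i ≢ j′ → j ≢ i′ → j ≢ j′ → VisibleDescent (A.conj x) i′ j′
    visible-persists i≢i′ i≢j′ j≢i′ j≢j′ =
      subst₂ (λ p q → A.τ (X p) F.< A.τ (X q)) (sym j′-fixed) (sym i′-fixed)
        (A.τ-mono (X j′) (X i′) (proj₁ vd′) not-crossing) ,
      λ conj-i′≡j′ → proj₂ vd′ (A.τ-injective
        (trans (trans (cong (A.τ ∘ X) (sym i′-fixed)) conj-i′≡j′) (sym j′-fixed)))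
      where
      i′-fixed : A.τ i′ ≡ i′
      i′-fixed = A.τ-other i′ (i≢i′ ∘ sym) (j≢i′ ∘ sym)
      j′-fixed : A.τ j′ ≡ j′
      j′-fixed = A.τ-other j′ (i≢j′ ∘ sym) (j≢j′ ∘ sym)
      not-crossing : ¬ (X j′ ≡ i × X i′ ≡ j)
      not-crossing (xj′≡i , xi′≡j) =
        <-asym (subst (F._< i) (trans (cong X (sym xi′≡j)) (proj₁ x-fpf i′)) (A.xj<i x x-fpf avoids vd))
               (subst (F._< i′) xj′≡i (A′.xj<i x x-fpf avoids vd′))

-- The Demazure conjugation ψ w = w⁻¹ ∘ w_fpf ∘ w

+-double-suc : ∀ c a b → b ≡ suc a → suc (suc (c + (a + a))) ≡ c + (b + b)
+-double-suc c a _ refl = begin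
  suc (suc (c + (a + a)))  ≡⟨ cong suc (+-suc c (a + a)) ⟨
  suc (c + suc (a + a))    ≡⟨ +-suc c (suc (a + a)) ⟨
  c + suc (suc (a + a))    ≡⟨ cong (λ t → c + suc t) (+-suc a a) ⟨
  c + (suc a + suc a)      ∎
  where open ≡-Reasoning

+-double-cancel-≤ : ∀ c a b → c + (a + a) ℕ.≤ c + (b + b) → a ℕ.≤ b
+-double-cancel-≤ c a b le with a ℕ.≤? b
... | yes a≤b = a≤b
... | no a≰b = ⊥-elim (<⇒≱ (+-mono-< (≰⇒> a≰b) (≰⇒> a≰b)) (+-cancelˡ-≤ c _ _ le))

module Demazure (n : ℕ) (_⊙_ : Perm (2 * n) → Perm (2 * n) → Perm (2 * n))
                (isDemazure : IsDemazureProduct _⊙_) where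

  open IsDemazureProduct isDemazure
  module ≈-Reasoning = Relation.Binary.Reasoning.Setoid (≈-setoid (2 * n))

  Perm₂ₙ : Set
  Perm₂ₙ = Perm (2 * n)

  W : Perm₂ₙ
  W = wfpf n

  ψ : Perm₂ₙ → Perm₂ₙ
  ψ w = (w ⁻¹) ⊙ (W ⊙ w)

  ⊙-congˡ : ∀ u u′ v → u ≈ u′ → (u ⊙ v) ≈ (u′ ⊙ v)
  ⊙-congˡ u u′ v u≈u′ = cong-⊙ {u} {u′} {v} {v} u≈u′ (λ _ → refl)

  ⊙-congʳ : ∀ u v v′ → v ≈ v′ → (u ⊙ v) ≈ (u ⊙ v′)
  ⊙-congʳ u v v′ v≈v′ = cong-⊙ {u} {u} {v} {v′} (λ _ → refl) v≈v′

  ψ-cong : ∀ w w′ → w ≈ w′ → ψ w ≈ ψ w′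
  ψ-cong w w′ w≈w′ = cong-⊙ {w ⁻¹} {w′ ⁻¹} {W ⊙ w} {W ⊙ w′} (⁻¹-cong w w′ w≈w′) (⊙-congʳ W w w′ w≈w′)

  module Step (i j : Fin (2 * n)) (j≡1+i : toℕ j ≡ suc (toℕ i)) where
    open Adjacent i j j≡1+i public

    s⊙-up : ∀ w → len (s · w) ≡ suc (len w) → (s ⊙ w) ≈ (s · w)
    s⊙-up w len-up = left-up s w s-simple (len-<⇒ℓ-< w (s · w) (≤-reflexive (sym len-up)))

    s⊙-down : ∀ w → len w ≡ suc (len (s · w)) → (s ⊙ w) ≈ w
    s⊙-down w len-down = left-down s w s-simple (<-asym (len-<⇒ℓ-< (s · w) w (≤-reflexive (sym len-down))))

    ⊙s-up : ∀ w → len (w · s) ≡ suc (len w) → (w ⊙ s) ≈ (w · s)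
    ⊙s-up w len-up = right-up s w s-simple (len-<⇒ℓ-< w (w · s) (≤-reflexive (sym len-up)))

    ⊙s-down : ∀ w → len w ≡ suc (len (w · s)) → (w ⊙ s) ≈ w
    ⊙s-down w len-down = right-down s w s-simple (<-asym (len-<⇒ℓ-< (w · s) w (≤-reflexive (sym len-down))))

    ψ-·s : (u : Perm₂ₙ) → u ⟨$⟩ʳ i F.< u ⟨$⟩ʳ j → ψ (u · s) ≈ (s ⊙ (ψ u ⊙ s))
    ψ-·s u ui<uj = begin
      ((u · s) ⁻¹) ⊙ (W ⊙ (u · s))  ≈⟨ cong-⊙ {(u · s) ⁻¹} {s ⊙ (u ⁻¹)} {W ⊙ (u · s)} {W ⊙ (u ⊙ s)}
                                           inverse-up (⊙-congʳ W (u · s) (u ⊙ s) λ k → sym (product-up k)) ⟩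
      (s ⊙ (u ⁻¹)) ⊙ (W ⊙ (u ⊙ s))  ≈⟨ assoc s (u ⁻¹) (W ⊙ (u ⊙ s)) ⟩
      s ⊙ ((u ⁻¹) ⊙ (W ⊙ (u ⊙ s)))  ≈⟨ ⊙-congʳ s _ _ (⊙-congʳ (u ⁻¹) _ _ (assoc W u s)) ⟨
      s ⊙ ((u ⁻¹) ⊙ ((W ⊙ u) ⊙ s))  ≈⟨ ⊙-congʳ s _ _ (assoc (u ⁻¹) (W ⊙ u) s) ⟨
      s ⊙ (ψ u ⊙ s)                 ∎
      where
      open ≈-Reasoning
      inverse-up : (u · s) ⁻¹ ≈ (s ⊙ (u ⁻¹))
      inverse-up k = trans (·s-⁻¹ u k)
        (sym (s⊙-up (u ⁻¹) (len-s·-up (u ⁻¹) (P.inverseˡ u) (P.inverseˡ u) ui<uj) k))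
      product-up : (u ⊙ s) ≈ (u · s)
      product-up = ⊙s-up u (len-·s-up u ui<uj)

    module _ (z : Perm₂ₙ) (z-fpf : IsFPFInvolution z) where

      ⊙-conj-up : z ⟨$⟩ʳ i F.< z ⟨$⟩ʳ j → (s ⊙ (z ⊙ s)) ≈ conj z
      ⊙-conj-up zi<zj k = trans (⊙-congʳ s (z ⊙ s) (z · s) (⊙s-up z (len-·s-up z zi<zj)) k)
                                (s⊙-up (z · s) (len-s·[z·s]-up z z-fpf zi<zj) k)

      ⊙-conj-down : z ⟨$⟩ʳ j F.< z ⟨$⟩ʳ i → (s ⊙ (z ⊙ s)) ≈ z
      ⊙-conj-down zj<zi k = trans (⊙-congʳ s (z ⊙ s) z (⊙s-down z (len-·s-down z zj<zi)) k)
                                  (s⊙-down z (len-s·-down z (proj₁ z-fpf i) (proj₁ z-fpf j) zj<zi) k)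

    ψ·s-Outcome : Perm₂ₙ → Set
    ψ·s-Outcome u =
      (ψ u ⟨$⟩ʳ i F.< ψ u ⟨$⟩ʳ j × ψ (u · s) ≈ conj (ψ u) × len (conj (ψ u)) ≡ suc (suc (len (ψ u))))
                  ⊎ (ψ u ⟨$⟩ʳ j F.< ψ u ⟨$⟩ʳ i × ψ (u · s) ≈ ψ u)

    ψ·s-outcome : (u : Perm₂ₙ) → u ⟨$⟩ʳ i F.< u ⟨$⟩ʳ j → IsFPFInvolution (ψ u) → ψ·s-Outcome u
    ψ·s-outcome u ui<uj ψu-fpf with ≢⇒<⊎> (i≢j ∘ ⟨$⟩ʳ-injective (ψ u))
    ... | inj₁ lt = inj₁ (lt , (λ k → trans (ψ-·s u ui<uj k) (⊙-conj-up (ψ u) ψu-fpf lt k)) ,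
                                len-conj-up (ψ u) ψu-fpf lt)
    ... | inj₂ gt = inj₂ (gt , λ k → trans (ψ-·s u ui<uj k) (⊙-conj-down (ψ u) ψu-fpf gt k))

    module RightDescentAt (w : Perm₂ₙ) (wj<wi : w ⟨$⟩ʳ j F.< w ⟨$⟩ʳ i) where
      u : Perm₂ₙ
      u = w · s

      w≈u·s : w ≈ u · s
      w≈u·s k = sym (·s·s w k)

      ψw≈ψ[u·s] : ψ w ≈ ψ (u · s)
      ψw≈ψ[u·s] = ψ-cong w (u · s) w≈u·s

      ℓw≡1+ℓu : len w ≡ suc (len u)
      ℓw≡1+ℓu = len-·s-down w wj<wi

      u-ascent : u ⟨$⟩ʳ i F.< u ⟨$⟩ʳ j
      u-ascent = subst₂ F._<_ (cong (w ⟨$⟩ʳ_) (sym τ-i)) (cong (w ⟨$⟩ʳ_) (sym τ-j)) wj<wi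

  ⊙-identityʳ : ∀ w → RightDescent w → (w ⊙ P.id) ≈ w
  ⊙-identityʳ w (i , j , j≡1+i , wj<wi) = begin
    w ⊙ P.id        ≈⟨ ⊙-congˡ w (u ⊙ s) P.id (λ k → trans (w≈u·s k) (sym (u⊙s k))) ⟩
    (u ⊙ s) ⊙ P.id  ≈⟨ assoc u s P.id ⟩
    u ⊙ (s ⊙ P.id)  ≈⟨ ⊙-congʳ u (s ⊙ P.id) s (s⊙-up P.id (len-s·-up P.id refl refl i<j)) ⟩
    u ⊙ s           ≈⟨ u⊙s ⟩
    u · s           ≈⟨ w≈u·s ⟨
    w               ∎
    where
    open ≈-Reasoning
    open Step i j j≡1+i
    open RightDescentAt w wj<wi
    u⊙s : (u ⊙ s) ≈ (u · s)
    u⊙s = ⊙s-up u (len-·s-up u u-ascent)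

  ⊙-identityˡ : ∀ w → RightDescent (w ⁻¹) → (P.id ⊙ w) ≈ w
  ⊙-identityˡ w (i , j , j≡1+i , w⁻¹j<w⁻¹i) = begin
    P.id ⊙ w        ≈⟨ ⊙-congʳ P.id w (s ⊙ v) (λ k → trans (sym (s·s· w k)) (sym (s⊙v k))) ⟩
    P.id ⊙ (s ⊙ v)  ≈⟨ assoc P.id s v ⟨
    (P.id ⊙ s) ⊙ v  ≈⟨ ⊙-congˡ (P.id ⊙ s) s v (⊙s-up P.id (len-·s-up P.id i<j)) ⟩
    s ⊙ v           ≈⟨ s⊙v ⟩
    s · v           ≈⟨ s·s· w ⟩
    w               ∎
    where
    open ≈-Reasoning
    open Step i j j≡1+i
    v : Perm₂ₙ
    v = s · w
    s⊙v : (s ⊙ v) ≈ (s · v)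
    s⊙v = s⊙-up v (len-s·-up v (trans (cong τ (P.inverseʳ w)) τ-j) (trans (cong τ (P.inverseʳ w)) τ-i) w⁻¹j<w⁻¹i)

  ψ-id : ψ P.id ≈ W
  ψ-id with descent⊎id W
  ... | inj₂ W≈id = λ k → ⊥-elim (proj₂ (wfpf-fpf n) k (W≈id k))
  ... | inj₁ (i , j , j≡1+i , Wj<Wi) = begin
    (P.id ⁻¹) ⊙ (W ⊙ P.id)  ≈⟨ ⊙-congˡ (P.id ⁻¹) P.id (W ⊙ P.id) (λ _ → refl) ⟩
    P.id ⊙ (W ⊙ P.id)       ≈⟨ ⊙-congʳ P.id (W ⊙ P.id) W (⊙-identityʳ W (i , j , j≡1+i , Wj<Wi)) ⟩
    P.id ⊙ W                ≈⟨ ⊙-identityˡ W (i , j , j≡1+i , W⁻¹j<W⁻¹i) ⟩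
    W                       ∎
    where
    open ≈-Reasoning
    W⁻¹≈W : W ⁻¹ ≈ W
    W⁻¹≈W = involution-⁻¹ W (proj₁ (wfpf-fpf n))
    W⁻¹j<W⁻¹i : W ⁻¹ ⟨$⟩ʳ j F.< W ⁻¹ ⟨$⟩ʳ i
    W⁻¹j<W⁻¹i = subst₂ F._<_ (sym (W⁻¹≈W j)) (sym (W⁻¹≈W i)) Wj<Wi

  ℓ₀ : ℕ
  ℓ₀ = len W

  ψ-bound : ∀ w → IsFPFInvolution (ψ w) × len (ψ w) ℕ.≤ ℓ₀ + (len w + len w)
  ψ-bound = len-rec _ step
    where
    step : ∀ w → (∀ {v} → len v ℕ.< len w → IsFPFInvolution (ψ v) × len (ψ v) ℕ.≤ ℓ₀ + (len v + len v)) →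
           IsFPFInvolution (ψ w) × len (ψ w) ℕ.≤ ℓ₀ + (len w + len w)
    step w ih with descent⊎id w
    ... | inj₂ w≈id = fpf-resp-≈ W (ψ w) (λ k → sym (ψw≈W k)) (wfpf-fpf n) ,
                      ≤-trans (≤-reflexive (len-cong (ψ w) W ψw≈W)) (m≤m+n ℓ₀ _)
      where
      ψw≈W : ψ w ≈ W
      ψw≈W k = trans (ψ-cong w P.id w≈id k) (ψ-id k)
    ... | inj₁ (i , j , j≡1+i , wj<wi) = from-u (ih (≤-reflexive (sym ℓw≡1+ℓu)))
      where
      open Step i j j≡1+i
      open RightDescentAt w wj<wi
      open ≤-Reasoning
      from-u : IsFPFInvolution (ψ u) × len (ψ u) ℕ.≤ ℓ₀ + (len u + len u) →
               IsFPFInvolution (ψ w) × len (ψ w) ℕ.≤ ℓ₀ + (len w + len w)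
      from-u (ψu-fpf , ψu-bound) with ψ·s-outcome u u-ascent ψu-fpf
      ... | inj₁ (_ , ψ[u·s]≈conj , len-conj) =
        fpf-resp-≈ (conj (ψ u)) (ψ w) (λ k → sym (ψw≈conj k)) (conj-fpf (ψ u) ψu-fpf) ,
        (begin
          len (ψ w)                         ≡⟨ len-cong (ψ w) (conj (ψ u)) ψw≈conj ⟩
          len (conj (ψ u))                  ≡⟨ len-conj ⟩
          suc (suc (len (ψ u)))             ≤⟨ s≤s (s≤s ψu-bound) ⟩
          suc (suc (ℓ₀ + (len u + len u)))  ≡⟨ +-double-suc ℓ₀ (len u) (len w) ℓw≡1+ℓu ⟩
          ℓ₀ + (len w + len w)              ∎)
        where
        ψw≈conj : ψ w ≈ conj (ψ u)
        ψw≈conj k = trans (ψw≈ψ[u·s] k) (ψ[u·s]≈conj k)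
      ... | inj₂ (_ , ψ[u·s]≈ψu) = fpf-resp-≈ (ψ u) (ψ w) (λ k → sym (ψw≈ψu k)) ψu-fpf ,
        (begin
          len (ψ w)             ≡⟨ len-cong (ψ w) (ψ u) ψw≈ψu ⟩
          len (ψ u)             ≤⟨ ψu-bound ⟩
          ℓ₀ + (len u + len u)  ≤⟨ +-monoʳ-≤ ℓ₀ (+-mono-≤ ℓu≤ℓw ℓu≤ℓw) ⟩
          ℓ₀ + (len w + len w)  ∎)
        where
        ψw≈ψu : ψ w ≈ ψ u
        ψw≈ψu k = trans (ψw≈ψ[u·s] k) (ψ[u·s]≈ψu k)
        ℓu≤ℓw : len u ℕ.≤ len w
        ℓu≤ℓw = ≤-trans (n≤1+n _) (≤-reflexive (sym ℓw≡1+ℓu))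

  IsAtom : Perm₂ₙ → Perm₂ₙ → Set
  IsAtom x v = ψ v ≈ x × ℓ₀ + (len v + len v) ≡ len x

  IsAtom-resp-≈ : ∀ x x′ v → x ≈ x′ → IsAtom x v → IsAtom x′ v
  IsAtom-resp-≈ x x′ v x≈x′ (ψv≈x , ℓv) = (λ k → trans (ψv≈x k) (x≈x′ k)) , trans ℓv (len-cong x x′ x≈x′)

  TwoAtoms : Perm₂ₙ → Set
  TwoAtoms x = Σ Perm₂ₙ λ v → Σ Perm₂ₙ λ v′ → IsAtom x v × IsAtom x v′ × ¬ (v ≈ v′)

  module AtomStep (i j : Fin (2 * n)) (j≡1+i : toℕ j ≡ suc (toℕ i)) where
    open Step i j j≡1+i public

    ψ-descent : ∀ w → w ⟨$⟩ʳ j F.< w ⟨$⟩ʳ i → ψ w ⟨$⟩ʳ j F.< ψ w ⟨$⟩ʳ i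
    ψ-descent w wj<wi = by-outcome (ψ·s-outcome u u-ascent (proj₁ (ψ-bound u)))
      where
      open RightDescentAt w wj<wi
      by-outcome : ψ·s-Outcome u → ψ w ⟨$⟩ʳ j F.< ψ w ⟨$⟩ʳ i
      by-outcome (inj₁ (ψu-ascent , ψ[u·s]≈conj , _)) =
        subst₂ F._<_ (sym (ψw≈conj j)) (sym (ψw≈conj i)) (proj₁ (conj-visible (ψ u) (proj₁ (ψ-bound u)) ψu-ascent))
        where
        ψw≈conj : ψ w ≈ conj (ψ u)
        ψw≈conj k = trans (ψw≈ψ[u·s] k) (ψ[u·s]≈conj k)
      by-outcome (inj₂ (ψu-descent , ψ[u·s]≈ψu)) =
        subst₂ F._<_ (sym (trans (ψw≈ψ[u·s] j) (ψ[u·s]≈ψu j))) (sym (trans (ψw≈ψ[u·s] i) (ψ[u·s]≈ψu i))) ψu-descent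

    atom-lift : ∀ x → IsFPFInvolution x → VisibleDescent x i j →
                ∀ u → IsAtom (conj x) u → u ⟨$⟩ʳ i F.< u ⟨$⟩ʳ j × IsAtom x (u · s)
    atom-lift x x-fpf vd u (ψu≈conj , ℓu) with ≢⇒<⊎> (i≢j ∘ ⟨$⟩ʳ-injective u)
    ... | inj₂ uj<ui = ⊥-elim (<-asym (conj-ascent x x-fpf vd)
                         (subst₂ F._<_ (ψu≈conj j) (ψu≈conj i) (ψ-descent u uj<ui)))
    ... | inj₁ ui<uj with ψ·s-outcome u ui<uj (proj₁ (ψ-bound u))
    ...   | inj₂ (ψu-descent , _) = ⊥-elim (<-asym (conj-ascent x x-fpf vd)
                                      (subst₂ F._<_ (ψu≈conj j) (ψu≈conj i) ψu-descent))
    ...   | inj₁ (_ , ψ[u·s]≈conj , _) = ui<uj ,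
      (λ k → trans (ψ[u·s]≈conj k) (trans (conj-cong (ψ u) (conj x) ψu≈conj k) (conj-involutive x k))) ,
      (begin
        ℓ₀ + (len (u · s) + len (u · s))  ≡⟨ +-double-suc ℓ₀ (len u) (len (u · s)) (len-·s-up u ui<uj) ⟨
        suc (suc (ℓ₀ + (len u + len u)))  ≡⟨ cong (ℕ.suc ∘ ℕ.suc) ℓu ⟩
        suc (suc (len (conj x)))          ≡⟨ len-visible x x-fpf vd ⟨
        len x                             ∎)
      where open ≡-Reasoning

    twoAtoms-lift : ∀ x → IsFPFInvolution x → VisibleDescent x i j → TwoAtoms (conj x) → TwoAtoms x
    twoAtoms-lift x x-fpf vd (u , u′ , u-atom , u′-atom , u≉u′) =
      u · s , u′ · s , proj₂ (atom-lift x x-fpf vd u u-atom) , proj₂ (atom-lift x x-fpf vd u′ u′-atom) ,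
      u≉u′ ∘ ·s-cancel u u′

    atom-descend : ∀ x v → IsAtom x v → v ⟨$⟩ʳ j F.< v ⟨$⟩ʳ i → VisibleDescent x i j × IsAtom (conj x) (v · s)
    atom-descend x v (ψv≈x , ℓv) vj<vi = by-outcome (ψ·s-outcome u u-ascent (proj₁ (ψ-bound u)))
      where
      open RightDescentAt v vj<vi
      by-outcome : ψ·s-Outcome u → VisibleDescent x i j × IsAtom (conj x) (v · s)
      by-outcome (inj₁ (ψu-ascent , ψ[u·s]≈conj , len-conj)) = visible , ψu≈conj , len-u
        where
        open ≡-Reasoning
        conj≈x : x ≈ conj (ψ u)
        conj≈x k = trans (sym (ψv≈x k)) (trans (ψw≈ψ[u·s] k) (ψ[u·s]≈conj k))
        visible : VisibleDescent x i j
        visible = let (lt , ne) = conj-visible (ψ u) (proj₁ (ψ-bound u)) ψu-ascent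
                  in subst₂ F._<_ (sym (conj≈x j)) (sym (conj≈x i)) lt , ne ∘ trans (sym (conj≈x i))
        ψu≈conj : ψ u ≈ conj x
        ψu≈conj k = trans (sym (conj-involutive (ψ u) k)) (conj-cong (conj (ψ u)) x (λ k → sym (conj≈x k)) k)
        len-u : ℓ₀ + (len u + len u) ≡ len (conj x)
        len-u = suc-injective (suc-injective (begin
          suc (suc (ℓ₀ + (len u + len u)))  ≡⟨ +-double-suc ℓ₀ (len u) (len v) ℓw≡1+ℓu ⟩
          ℓ₀ + (len v + len v)              ≡⟨ ℓv ⟩
          len x                             ≡⟨ len-cong x (conj (ψ u)) conj≈x ⟩
          len (conj (ψ u))                  ≡⟨ len-conj ⟩
          suc (suc (len (ψ u)))             ≡⟨ cong (ℕ.suc ∘ ℕ.suc) (len-cong (ψ u) (conj x) ψu≈conj) ⟩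
          suc (suc (len (conj x)))          ∎))
      by-outcome (inj₂ (_ , ψ[u·s]≈ψu)) = ⊥-elim (<-irrefl refl (≤-trans (n≤1+n _) too-long))
        where
        open ≤-Reasoning
        x≈ψu : x ≈ ψ u
        x≈ψu k = trans (sym (ψv≈x k)) (trans (ψw≈ψ[u·s] k) (ψ[u·s]≈ψu k))
        too-long : suc (suc (ℓ₀ + (len u + len u))) ℕ.≤ ℓ₀ + (len u + len u)
        too-long = begin
          suc (suc (ℓ₀ + (len u + len u)))  ≡⟨ +-double-suc ℓ₀ (len u) (len v) ℓw≡1+ℓu ⟩
          ℓ₀ + (len v + len v)              ≡⟨ ℓv ⟩
          len x                             ≡⟨ len-cong x (ψ u) x≈ψu ⟩
          len (ψ u)                         ≤⟨ proj₂ (ψ-bound u) ⟩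
          ℓ₀ + (len u + len u)              ∎

  atom-exists : ∀ x → IsFPFInvolution x → Σ Perm₂ₙ (IsAtom x)
  atom-exists = len-rec _ step
    where
    step : ∀ x → (∀ {y} → len y ℕ.< len x → IsFPFInvolution y → Σ Perm₂ₙ (IsAtom y)) →
           IsFPFInvolution x → Σ Perm₂ₙ (IsAtom x)
    step x ih x-fpf with visibleDescent⊎wfpf {n} x x-fpf
    ... | inj₂ x≈W = P.id , (λ k → trans (ψ-id k) (sym (x≈W k))) ,
                     trans (cong (λ l → ℓ₀ + (l + l)) (len-id {2 * n}))
                           (trans (+-comm ℓ₀ 0) (len-cong W x λ k → sym (x≈W k)))
    ... | inj₁ (i , j , j≡1+i , vd) =
      let u , u-atom = ih {conj x} (≤-trans (n≤1+n _) (≤-reflexive (sym (len-visible x x-fpf vd)))) (conj-fpf x x-fpf)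
      in u · s , proj₂ (atom-lift x x-fpf vd u u-atom)
      where open AtomStep i j j≡1+i

  atom⇒minimal : ∀ x v → IsAtom x v → InAFPF n _⊙_ x v
  atom⇒minimal x v (ψv≈x , ℓv) = ψv≈x , λ v′ ψv′≈x → len-≤⇒ℓ-≤ v v′ $ +-double-cancel-≤ ℓ₀ (len v) (len v′)
    (≤-trans (≤-reflexive (trans ℓv (sym (len-cong (ψ v′) x ψv′≈x)))) (proj₂ (ψ-bound v′)))

  minimal⇒atom : ∀ x v → IsFPFInvolution x → InAFPF n _⊙_ x v → IsAtom x v
  minimal⇒atom x v x-fpf (ψv≈x , minimal) = ψv≈x , ≤-antisym at-most at-least
    where
    a = atom-exists x x-fpf
    ℓv≤ℓa : len v ℕ.≤ len (proj₁ a)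
    ℓv≤ℓa = ℓ-≤⇒len-≤ v (proj₁ a) (minimal (proj₁ a) (proj₁ (proj₂ a)))
    at-most : ℓ₀ + (len v + len v) ℕ.≤ len x
    at-most = ≤-trans (+-monoʳ-≤ ℓ₀ (+-mono-≤ ℓv≤ℓa ℓv≤ℓa)) (≤-reflexive (proj₂ (proj₂ a)))
    at-least : len x ℕ.≤ ℓ₀ + (len v + len v)
    at-least = ≤-trans (≤-reflexive (sym (len-cong (ψ v) x ψv≈x))) (proj₂ (ψ-bound v))

  atoms-equal-length : ∀ x v v′ → IsAtom x v → IsAtom x v′ → len v ≡ len v′
  atoms-equal-length x v v′ (_ , ℓv) (_ , ℓv′) =
    ≤-antisym (+-double-cancel-≤ ℓ₀ _ _ (≤-reflexive (trans ℓv (sym ℓv′))))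
              (+-double-cancel-≤ ℓ₀ _ _ (≤-reflexive (trans ℓv′ (sym ℓv))))

  Unique : Perm₂ₙ → Set
  Unique x = ∀ v v′ → IsAtom x v → IsAtom x v′ → v ≈ v′

  module UniquenessStep (x : Perm₂ₙ) (x-fpf : IsFPFInvolution x) (avoids : ¬ Pattern321 x)
    (ih : ∀ {y} → len y ℕ.< len x → IsFPFInvolution y → ¬ Pattern321 y → Unique y) where

    unique-conj : ∀ i j (j≡1+i : toℕ j ≡ suc (toℕ i)) → VisibleDescent x i j → Unique (Adjacent.conj i j j≡1+i x)
    unique-conj i j j≡1+i vd = ih (≤-trans (n≤1+n _) (≤-reflexive (sym (len-visible x x-fpf vd))))
                                  (conj-fpf x x-fpf) (avoids-conj x x-fpf avoids vd)
      where open Adjacent i j j≡1+i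

    same-descent : ∀ i j (j≡1+i : toℕ j ≡ suc (toℕ i)) v v′ → IsAtom x v → IsAtom x v′ →
                   v ⟨$⟩ʳ j F.< v ⟨$⟩ʳ i → v′ ⟨$⟩ʳ j F.< v′ ⟨$⟩ʳ i → v ≈ v′
    same-descent i j j≡1+i v v′ v-atom v′-atom vj<vi v′j<v′i = ·s-cancel v v′
      (unique-conj i j j≡1+i (proj₁ (atom-descend x v v-atom vj<vi)) (v · s) (v′ · s)
                   (proj₂ (atom-descend x v v-atom vj<vi)) (proj₂ (atom-descend x v′ v′-atom v′j<v′i)))
      where open AtomStep i j j≡1+i

    -- v·s_i and v′·s_i′ are both compared, by induction, with lifts of one atom r of
    -- s_i′ s_i x s_i s_i′ = s_i s_i′ x s_i′ s_i.
    distinct-descents : ∀ i j (j≡1+i : toℕ j ≡ suc (toℕ i)) i′ j′ (j′≡1+i′ : toℕ j′ ≡ suc (toℕ i′)) v v′ →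
                        IsAtom x v → IsAtom x v′ → v ⟨$⟩ʳ j F.< v ⟨$⟩ʳ i → v′ ⟨$⟩ʳ j′ F.< v′ ⟨$⟩ʳ i′ →
                        i ≢ i′ → v ≈ v′
    distinct-descents i j j≡1+i i′ j′ j′≡1+i′ v v′ v-atom v′-atom vj<vi v′j′<v′i′ i≢i′ k = begin
      v ⟨$⟩ʳ k               ≡⟨ cong (v ⟨$⟩ʳ_) (S.τ-involutive k) ⟨
      v ⟨$⟩ʳ S.τ (S.τ k)     ≡⟨ v·s≈r·s′ (S.τ k) ⟩
      r ⟨$⟩ʳ S′.τ (S.τ k)    ≡⟨ cong (r ⟨$⟩ʳ_) (τ-commute i≢i′ i≢j′ j≢i′ j≢j′ k) ⟨
      r ⟨$⟩ʳ S.τ (S′.τ k)    ≡⟨ v′·s′≈r·s (S′.τ k) ⟨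
      v′ ⟨$⟩ʳ S′.τ (S′.τ k)  ≡⟨ cong (v′ ⟨$⟩ʳ_) (S′.τ-involutive k) ⟩
      v′ ⟨$⟩ʳ k              ∎
      where
      open ≡-Reasoning
      module S = AtomStep i j j≡1+i
      module S′ = AtomStep i′ j′ j′≡1+i′
      open TwoAdjacent i j j≡1+i i′ j′ j′≡1+i′
      module T′ = TwoAdjacent i′ j′ j′≡1+i′ i j j≡1+i
      vd = proj₁ (S.atom-descend x v v-atom vj<vi)
      vd′ = proj₁ (S′.atom-descend x v′ v′-atom v′j′<v′i′)
      i≢j′ : i ≢ j′
      i≢j′ = T′.visible-apart x x-fpf avoids vd′ vd
      j≢i′ : j ≢ i′
      j≢i′ = visible-apart x x-fpf avoids vd vd′ ∘ sym
      j≢j′ : j ≢ j′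
      j≢j′ j≡j′ = i≢i′ (toℕ-injective (suc-injective (trans (sym j≡1+i) (trans (cong toℕ j≡j′) j′≡1+i′))))
      x₁ = S.conj x
      x₂ = S′.conj x
      x₁-fpf = S.conj-fpf x x-fpf
      x₂-fpf = S′.conj-fpf x x-fpf
      vd₁′ : VisibleDescent x₁ i′ j′
      vd₁′ = visible-persists x x-fpf avoids vd vd′ i≢i′ i≢j′ j≢i′ j≢j′
      vd₂ : VisibleDescent x₂ i j
      vd₂ = T′.visible-persists x x-fpf avoids vd′ vd (i≢i′ ∘ sym) (j≢i′ ∘ sym) (i≢j′ ∘ sym) (j≢j′ ∘ sym)
      y = S′.conj x₁
      y≈ : y ≈ S.conj x₂
      y≈ k = trans (sym (τ-commute i≢i′ i≢j′ j≢i′ j≢j′ (x ⟨$⟩ʳ S.τ (S′.τ k))))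
                   (cong (λ b → S.τ (S′.τ (x ⟨$⟩ʳ b))) (τ-commute i≢i′ i≢j′ j≢i′ j≢j′ k))
      r-atom = atom-exists y (S′.conj-fpf x₁ x₁-fpf)
      r = proj₁ r-atom
      v·s≈r·s′ : v · S.s ≈ r · S′.s
      v·s≈r·s′ = unique-conj i j j≡1+i vd (v · S.s) (r · S′.s) (proj₂ (S.atom-descend x v v-atom vj<vi))
        (proj₂ (S′.atom-lift x₁ x₁-fpf vd₁′ r (proj₂ r-atom)))
      v′·s′≈r·s : v′ · S′.s ≈ r · S.s
      v′·s′≈r·s = unique-conj i′ j′ j′≡1+i′ vd′ (v′ · S′.s) (r · S.s) (proj₂ (S′.atom-descend x v′ v′-atom v′j′<v′i′))
        (proj₂ (S.atom-lift x₂ x₂-fpf vd₂ r (IsAtom-resp-≈ y (S.conj x₂) r y≈ (proj₂ r-atom))))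

  atom-unique : ∀ x → IsFPFInvolution x → ¬ Pattern321 x → Unique x
  atom-unique = len-rec _ step
    where
    step : ∀ x → (∀ {y} → len y ℕ.< len x → IsFPFInvolution y → ¬ Pattern321 y → Unique y) →
           IsFPFInvolution x → ¬ Pattern321 x → Unique x
    step x ih x-fpf avoids v v′ v-atom v′-atom = by-descents (descent⊎id v) (descent⊎id v′)
      where
      open UniquenessStep x x-fpf avoids ih
      ¬descent-beside-identity : ∀ w w′ → IsAtom x w → IsAtom x w′ → w ≈ P.id → ¬ RightDescent w′
      ¬descent-beside-identity w w′ w-atom w′-atom w≈id (i , j , j≡1+i , w′j<w′i) = 0≢1+n (begin
        0         ≡⟨ len-id ⟨
        len P.id  ≡⟨ len-cong w P.id w≈id ⟨
        len w     ≡⟨ atoms-equal-length x w w′ w-atom w′-atom ⟩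
        len w′    ≡⟨ Adjacent.len-·s-down i j j≡1+i w′ w′j<w′i ⟩
        suc _     ∎)
        where open ≡-Reasoning
      by-descents : RightDescent v ⊎ v ≈ P.id → RightDescent v′ ⊎ v′ ≈ P.id → v ≈ v′
      by-descents (inj₂ v≈id) (inj₂ v′≈id) k = trans (v≈id k) (sym (v′≈id k))
      by-descents (inj₂ v≈id) (inj₁ d′) = ⊥-elim (¬descent-beside-identity v v′ v-atom v′-atom v≈id d′)
      by-descents (inj₁ d) (inj₂ v′≈id) = ⊥-elim (¬descent-beside-identity v′ v v′-atom v-atom v′≈id d)
      by-descents (inj₁ (i , j , j≡1+i , vj<vi)) (inj₁ (i′ , j′ , j′≡1+i′ , v′j′<v′i′)) with i ≟ i′
      ... | yes refl = same-descent i j j≡1+i v v′ v-atom v′-atom vj<vi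
                         (subst (λ b → v′ ⟨$⟩ʳ b F.< v′ ⟨$⟩ʳ i)
                                (toℕ-injective (trans j′≡1+i′ (sym j≡1+i))) v′j′<v′i′)
      ... | no i≢i′ = distinct-descents i j j≡1+i i′ j′ j′≡1+i′ v v′ v-atom v′-atom vj<vi v′j′<v′i′ i≢i′

  module NonUniquenessStep (x : Perm₂ₙ) (x-fpf : IsFPFInvolution x)
    (ih : ∀ {y} → len y ℕ.< len x → IsFPFInvolution y → HasNesting y → TwoAtoms y) where

    private
      X : Fin (2 * n) → Fin (2 * n)
      X k = x ⟨$⟩ʳ k
      x-invol : ∀ k → X (X k) ≡ k
      x-invol = proj₁ x-fpf

    via-conj : ∀ i j (j≡1+i : toℕ j ≡ suc (toℕ i)) → VisibleDescent x i j →
               HasNesting (Adjacent.conj i j j≡1+i x) → TwoAtoms x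
    via-conj i j j≡1+i vd nesting = twoAtoms-lift x x-fpf vd
      (ih (≤-trans (n≤1+n _) (≤-reflexive (sym (len-visible x x-fpf vd)))) (conj-fpf x x-fpf) nesting)
      where open AtomStep i j j≡1+i

    -- Conjugating by s_a and by s_b′ gives the same involution; one atom of it lifts to two atoms of x.
    tight-nesting : ∀ a a′ → toℕ a′ ≡ suc (toℕ a) → toℕ (X a) ≡ suc (toℕ (X a′)) → a′ F.< X a′ → TwoAtoms x
    tight-nesting a a′ a′≡1+a b≡1+b′ a′<b′ =
      r · S.s , r · S′.s , proj₂ (S.atom-lift x x-fpf vd r (proj₂ r-atom)) ,
      proj₂ (S′.atom-lift x x-fpf vd′ r (IsAtom-resp-≈ (S.conj x) (S′.conj x) r same-conj (proj₂ r-atom))) ,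
      λ r·s≈r·s′ → <⇒≢ a<a′
        (sym (trans (sym S.τ-i) (trans (⟨$⟩ʳ-injective r (r·s≈r·s′ a)) (S′.τ-other a a≢b′ a≢b))))
      where
      b = X a
      b′ = X a′
      module S = AtomStep a a′ a′≡1+a
      module S′ = AtomStep b′ b b≡1+b′
      a<a′ = S.i<j
      b′<b = S′.i<j
      a<b′ = <-trans a<a′ a′<b′
      a′<b = <-trans a′<b′ b′<b
      a≢b′ = <⇒≢ a<b′
      a≢b = <⇒≢ (<-trans a<b′ b′<b)
      a′≢b′ = <⇒≢ a′<b′
      a′≢b = <⇒≢ a′<b
      vd : VisibleDescent x a a′
      vd = b′<b , a′≢b ∘ sym
      vd′ : VisibleDescent x b′ b
      vd′ = subst₂ F._<_ (sym (x-invol a)) (sym (x-invol a′)) a<a′ ,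
            λ xb′≡b → a′≢b (trans (sym (x-invol a′)) xb′≡b)
      r-atom = atom-exists (S.conj x) (S.conj-fpf x x-fpf)
      r = proj₁ r-atom
      same-conj : S.conj x ≈ S′.conj x
      same-conj k = by-cases (k ≟ a) (k ≟ a′) (k ≟ b′) (k ≟ b)
        where
        open ≡-Reasoning
        by-cases : Dec (k ≡ a) → Dec (k ≡ a′) → Dec (k ≡ b′) → Dec (k ≡ b) →
                   S.τ (X (S.τ k)) ≡ S′.τ (X (S′.τ k))
        by-cases (yes refl) _ _ _ = begin
          S.τ (X (S.τ a))    ≡⟨ cong (S.τ ∘ X) S.τ-i ⟩
          S.τ b′             ≡⟨ S.τ-other b′ (a≢b′ ∘ sym) (a′≢b′ ∘ sym) ⟩
          b′                 ≡⟨ S′.τ-j ⟨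
          S′.τ b             ≡⟨ cong (S′.τ ∘ X) (S′.τ-other a a≢b′ a≢b) ⟨
          S′.τ (X (S′.τ a))  ∎
        by-cases (no _) (yes refl) _ _ = begin
          S.τ (X (S.τ a′))    ≡⟨ cong (S.τ ∘ X) S.τ-j ⟩
          S.τ b               ≡⟨ S.τ-other b (a≢b ∘ sym) (a′≢b ∘ sym) ⟩
          b                   ≡⟨ S′.τ-i ⟨
          S′.τ b′             ≡⟨ cong (S′.τ ∘ X) (S′.τ-other a′ a′≢b′ a′≢b) ⟨
          S′.τ (X (S′.τ a′))  ∎
        by-cases (no _) (no _) (yes refl) _ = begin
          S.τ (X (S.τ b′))    ≡⟨ cong (S.τ ∘ X) (S.τ-other b′ (a≢b′ ∘ sym) (a′≢b′ ∘ sym)) ⟩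
          S.τ (X b′)          ≡⟨ cong S.τ (x-invol a′) ⟩
          S.τ a′              ≡⟨ S.τ-j ⟩
          a                   ≡⟨ S′.τ-other a a≢b′ a≢b ⟨
          S′.τ a              ≡⟨ cong S′.τ (x-invol a) ⟨
          S′.τ (X b)          ≡⟨ cong (S′.τ ∘ X) S′.τ-i ⟨
          S′.τ (X (S′.τ b′))  ∎
        by-cases (no _) (no _) (no _) (yes refl) = begin
          S.τ (X (S.τ b))    ≡⟨ cong (S.τ ∘ X) (S.τ-other b (a≢b ∘ sym) (a′≢b ∘ sym)) ⟩
          S.τ (X b)          ≡⟨ cong S.τ (x-invol a) ⟩
          S.τ a              ≡⟨ S.τ-i ⟩
          a′                 ≡⟨ S′.τ-other a′ a′≢b′ a′≢b ⟨
          S′.τ a′            ≡⟨ cong S′.τ (x-invol a′) ⟨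
          S′.τ (X b′)        ≡⟨ cong (S′.τ ∘ X) S′.τ-j ⟨
          S′.τ (X (S′.τ b))  ∎
        by-cases (no k≢a) (no k≢a′) (no k≢b′) (no k≢b) = begin
          S.τ (X (S.τ k))  ≡⟨ cong (S.τ ∘ X) (S.τ-other k k≢a k≢a′) ⟩
          S.τ (X k)        ≡⟨ S.τ-other (X k) (k≢b ∘ image a) (k≢b′ ∘ image a′) ⟩
          X k              ≡⟨ S′.τ-other (X k) (λ e → k≢a′ (trans (image b′ e) (x-invol a′)))
                                                 (λ e → k≢a (trans (image b e) (x-invol a))) ⟨
          S′.τ (X k)         ≡⟨ cong (S′.τ ∘ X) (S′.τ-other k k≢b′ k≢b) ⟨
          S′.τ (X (S′.τ k))  ∎
          where
          image : ∀ c → X k ≡ c → k ≡ X c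
          image c xk≡c = trans (sym (x-invol k)) (cong X xk≡c)

    module _ (i j : Fin (2 * n)) (j≡1+i : toℕ j ≡ suc (toℕ i)) (vd : VisibleDescent x i j)
             (no-nesting : ¬ HasNesting (Adjacent.conj i j j≡1+i x))
             (a a′ : Fin (2 * n)) (a<a′ : a F.< a′) (a′<b′ : a′ F.< X a′) (b′<b : X a′ F.< X a) where

      private
        b b′ : Fin (2 * n)
        b = X a
        b′ = X a′
        a<b′ = <-trans a<a′ a′<b′
        a<b = <-trans a<b′ b′<b
        a′<b = <-trans a′<b′ b′<b
        nesting-survives = Adjacent.nesting-conj i j j≡1+i x vd

      left-ends-at-descent : a ≡ i → a′ ≡ j → TwoAtoms x
      left-ends-at-descent a≡i a′≡j = by-gap (toℕ b ℕ.≟ suc (toℕ b′))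
        where
        a′≡1+a : toℕ a′ ≡ suc (toℕ a)
        a′≡1+a = trans (cong toℕ a′≡j) (trans j≡1+i (cong (ℕ.suc ∘ toℕ) (sym a≡i)))
        by-gap : Dec (toℕ b ≡ suc (toℕ b′)) → TwoAtoms x
        by-gap (yes b≡1+b′) = tight-nesting a a′ a′≡1+a b≡1+b′ a′<b′
        by-gap (no b≢1+b′) = [ outside , inside ]′ (≢⇒<⊎> xK≢a)
          where
          K = proj₁ (predecessor b (≤-trans (s≤s z≤n) a<b))
          b≡1+K : toℕ b ≡ suc (toℕ K)
          b≡1+K = proj₂ (predecessor b (≤-trans (s≤s z≤n) a<b))
          b′<K : b′ F.< K
          b′<K = ≤∧≢⇒< (≤-pred (subst (toℕ b′ ℕ.<_) b≡1+K b′<b))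
                       λ b′≡K → b≢1+b′ (trans b≡1+K (cong ℕ.suc (sym b′≡K)))
          a<K = <-trans a<b′ b′<K
          xK≢a : X K ≢ a
          xK≢a xK≡a = 1+n≢n (trans (sym b≡1+K) (cong toℕ (trans (cong X (sym xK≡a)) (x-invol K))))
          outside : X K F.< a → TwoAtoms x
          outside xK<a = ⊥-elim (no-nesting (nesting-survives (X K) a′ (<-trans xK<a a<a′) a′<b′
            (subst (b′ F.<_) (sym (x-invol K)) b′<K)
            (λ (xK≡i , _) → <⇒≢ xK<a (trans xK≡i (sym a≡i)))
            (λ (b′≡i , _) → <⇒≢ a<b′ (trans a≡i (sym b′≡i)))))
          inside : a F.< X K → TwoAtoms x
          inside a<xK = via-conj K b b≡1+K vdK (Adjacent.nesting-conj K b b≡1+K x vdK a a′ a<a′ a′<b′ b′<b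
            (λ (a≡K , _) → <⇒≢ a<K a≡K) (λ (b′≡K , _) → <⇒≢ b′<K b′≡K))
            where
            vdK : VisibleDescent x K b
            vdK = subst (F._< X K) (sym (x-invol a)) a<xK ,
                  λ xK≡b → <⇒≢ a<K (sym (trans (sym (x-invol K)) (trans (cong X xK≡b) (x-invol a))))

      right-ends-at-descent : b′ ≡ i → b ≡ j → TwoAtoms x
      right-ends-at-descent b′≡i b≡j = by-gap (toℕ a′ ℕ.≟ suc (toℕ a))
        where
        b≡1+b′ : toℕ b ≡ suc (toℕ b′)
        b≡1+b′ = trans (cong toℕ b≡j) (trans j≡1+i (cong (ℕ.suc ∘ toℕ) (sym b′≡i)))
        by-gap : Dec (toℕ a′ ≡ suc (toℕ a)) → TwoAtoms x
        by-gap (yes a′≡1+a) = tight-nesting a a′ a′≡1+a b≡1+b′ a′<b′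
        by-gap (no a′≢1+a) = [ below , above ]′ (≢⇒<⊎> xK≢a)
          where
          K = proj₁ (successor a a′ a<a′)
          K≡1+a : toℕ K ≡ suc (toℕ a)
          K≡1+a = proj₂ (successor a a′ a<a′)
          K<a′ : K F.< a′
          K<a′ = ≤∧≢⇒< (subst (ℕ._≤ toℕ a′) (sym K≡1+a) a<a′)
                       λ K≡a′ → a′≢1+a (trans (sym K≡a′) K≡1+a)
          a<K : a F.< K
          a<K = subst (toℕ a ℕ.<_) (sym K≡1+a) (n<1+n _)
          K<b′ = <-trans K<a′ a′<b′
          K<b = <-trans K<b′ b′<b
          xK≢a : X K ≢ a
          xK≢a xK≡a = <⇒≢ K<b (trans (sym (x-invol K)) (cong X xK≡a))
          below : X K F.< a → TwoAtoms x
          below xK<a = via-conj a K K≡1+a vdA (Adjacent.nesting-conj a K K≡1+a x vdA a a′ a<a′ a′<b′ b′<b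
            (λ (_ , a′≡K) → <⇒≢ K<a′ (sym a′≡K)) (λ (b′≡a , _) → <⇒≢ a<b′ (sym b′≡a)))
            where
            vdA : VisibleDescent x a K
            vdA = <-trans xK<a a<b , <⇒≢ K<b ∘ sym
          above : a F.< X K → TwoAtoms x
          above a<xK = [ nested-in-pair , nested-around-pair ]′ (≢⇒<⊎> xK≢b)
            where
            xK≢b : X K ≢ b
            xK≢b xK≡b = <⇒≢ a<K (sym (trans (sym (x-invol K)) (trans (cong X xK≡b) (x-invol a))))
            K<xK : K F.< X K
            K<xK = ≤∧≢⇒< (subst (ℕ._≤ toℕ (X K)) (sym K≡1+a) a<xK)
                         λ K≡xK → proj₂ x-fpf K (toℕ-injective (sym K≡xK))
            nested-in-pair : X K F.< b → TwoAtoms x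
            nested-in-pair xK<b = ⊥-elim (no-nesting (nesting-survives a K a<K K<xK xK<b
              (λ (a≡i , _) → <⇒≢ a<b′ (trans a≡i (sym b′≡i)))
              (λ (xK≡i , _) → <⇒≢ K<a′
                 (trans (sym (x-invol K)) (trans (cong X (trans xK≡i (sym b′≡i))) (x-invol a′))))))
            nested-around-pair : b F.< X K → TwoAtoms x
            nested-around-pair b<xK = ⊥-elim (no-nesting (nesting-survives K a′ K<a′ a′<b′ (<-trans b′<b b<xK)
              (λ (K≡i , _) → <⇒≢ K<b′ (trans K≡i (sym b′≡i)))
              (λ (_ , xK≡j) → <⇒≢ b<xK (sym (trans xK≡j (sym b≡j))))))

      nesting-meets-descent : TwoAtoms x
      nesting-meets-descent with (a ≟ i) ×-dec (a′ ≟ j) | (X a′ ≟ i) ×-dec (X a ≟ j)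
      ... | yes (a≡i , a′≡j) | _ = left-ends-at-descent a≡i a′≡j
      ... | no _ | yes (b′≡i , b≡j) = right-ends-at-descent b′≡i b≡j
      ... | no not-ij | no not-x-ij = ⊥-elim (no-nesting (nesting-survives a a′ a<a′ a′<b′ b′<b not-ij not-x-ij))

    twoAtoms : HasNesting x → TwoAtoms x
    twoAtoms (a , a′ , a<a′ , a′<b′ , b′<b) with visibleDescent⊎wfpf {n} x x-fpf
    ... | inj₂ x≈W = ⊥-elim (wfpf-noNesting n (HasNesting-resp-≈ x W x≈W (a , a′ , a<a′ , a′<b′ , b′<b)))
    ... | inj₁ (i , j , j≡1+i , vd) with hasNesting? (Adjacent.conj i j j≡1+i x)
    ...   | yes nesting = via-conj i j j≡1+i vd nesting
    ...   | no no-nesting = nesting-meets-descent i j j≡1+i vd no-nesting a a′ a<a′ a′<b′ b′<b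

  nesting⇒twoAtoms : ∀ x → IsFPFInvolution x → HasNesting x → TwoAtoms x
  nesting⇒twoAtoms = len-rec _ λ x ih x-fpf → NonUniquenessStep.twoAtoms x x-fpf ih

corollary6p26 : (n : ℕ) (_⊙_ : Perm (2 * n) → Perm (2 * n) → Perm (2 * n)) →
                IsDemazureProduct _⊙_ →
                (x : Perm (2 * n)) → IsFPFInvolution x →
                (AFPFSingleton n _⊙_ x → Avoids321 x) × (Avoids321 x → AFPFSingleton n _⊙_ x)
corollary6p26 n _⊙_ isDemazure x x-fpf = singleton⇒avoids , avoids⇒singleton
  where
  open Demazure n _⊙_ isDemazure
  singleton⇒avoids : AFPFSingleton n _⊙_ x → Avoids321 x
  singleton⇒avoids (w , _ , only-w) has321 =
    let v , v′ , v-atom , v′-atom , v≉v′ = nesting⇒twoAtoms x x-fpf (pattern321⇒nesting x x-fpf has321)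
    in v≉v′ λ k → trans (only-w v (atom⇒minimal x v v-atom) k) (sym (only-w v′ (atom⇒minimal x v′ v′-atom) k))
  avoids⇒singleton : Avoids321 x → AFPFSingleton n _⊙_ x
  avoids⇒singleton avoids =
    let w , w-atom = atom-exists x x-fpf
    in w , atom⇒minimal x w w-atom ,
       λ v v-minimal → atom-unique x x-fpf avoids v w (minimal⇒atom x v x-fpf v-minimal) w-atom
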